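{- For $k\ge 0$ define strings over $\{a,b\}$ by $B_0=b$ and, for $i\ge 1$, $B_i=(a^iba^1b)(a^iba^2b)\cdots(a^iba^{i-1}b)\,a^ib$ (so $B_1=ab$, $B_2=a^2baba^2b$), and let $s_k=B_0B_1\cdots B_k\,a$. For $k\ge 2$, let $m_k$ be the size of the Lyndon factorization of $s_k$ and $z_k$ the size of the non-overlapping LZ factorization of $s_k$. Then $m_k=k^2/2+k/2+2$, $z_k=k^2/2-k/2+4$, and thus $m_k=z_k+\Theta(\sqrt{z_k})$.
   Context: The alphabet is $\{a,b\}$ ordered by $a\prec b$; $u^j$ denotes $j$ concatenated copies of $u$. Lexicographic order: $u\preceq v$ if either $u$ is a prefix of $v$, or $u=xcw_1$, $v=xdw_2$ with letters $c\prec d$. A Lyndon word is a nonempty string strictly lexicographically smaller than each of its nonempty proper suffixes. The Lyndon factorization of $s$ is the unique factorization $s=f_1^{e_1}\cdots f_m^{e_m}$ with each $f_i$ a Lyndon word, $e_i\ge1$, and $f_i\succ f_{i+1}$; its size is $m$. The non-overlapping LZ factorization $s=p_1\cdots p_z$ is built greedily left to right: each phrase $p_i$ is either the leftmost occurrence in $s$ of a letter, or the longest prefix of $p_i\cdots p_z$ occurring as a substring of $p_1\cdots p_{i-1}$; its size is $z$. -}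

module Defs where

open import Data.Nat using (ℕ; zero; suc; _≤_)
open import Data.List using (List; []; _∷_; _++_; [_]; concat; map; replicate; length; upTo)
open import Data.List.Relation.Unary.All using (All)
open import Data.List.Relation.Unary.Linked using (Linked)
open import Data.List.Membership.Propositional using (_∈_)
open import Data.Product using (Σ; ∃; _×_; _,_)
open import Data.Sum using (_⊎_)
open import Relation.Binary.PropositionalEquality using (_≡_; _≢_)
open import Relation.Nullary using (¬_)

data Letter : Set where
  a b : Letter

data _≺ₗ_ : Letter → Letter → Set where
  a≺b : a ≺ₗ b

Word : Set
Word = List Letter

_^ʷ_ : Word → ℕ → Word
u ^ʷ j = concat (replicate j u)

_⪯_ : Word → Word → Set
u ⪯ v = (∃ λ w → u ++ w ≡ v)
      ⊎ (Σ Word λ x → Σ Letter λ c → Σ Letter λ d → Σ Word λ w₁ → Σ Word λ w₂ →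
           c ≺ₗ d × u ≡ x ++ (c ∷ w₁) × v ≡ x ++ (d ∷ w₂))

_≺_ : Word → Word → Set
u ≺ v = u ⪯ v × u ≢ v

IsLyndon : Word → Set
IsLyndon w = w ≢ [] × (∀ x y → x ++ y ≡ w → x ≢ [] → y ≢ [] → w ≺ y)

pow : Word × ℕ → Word
pow (f , e) = f ^ʷ e

Decr : Word × ℕ → Word × ℕ → Set
Decr (f , _) (g , _) = g ≺ f

GoodFactor : Word × ℕ → Set
GoodFactor (f , e) = IsLyndon f × 1 ≤ e

-- fs = [(f₁,e₁),…,(f_m,e_m)] is a Lyndon factorization of s; its size is length fs
IsLyndonFactorization : Word → List (Word × ℕ) → Set
IsLyndonFactorization s fs =
  concat (map pow fs) ≡ s × All GoodFactor fs × Linked Decr fs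

Prefix : Word → Word → Set
Prefix q r = ∃ λ y → q ++ y ≡ r

Substring : Word → Word → Set
Substring u v = Σ Word λ x → Σ Word λ y → x ++ (u ++ y) ≡ v

-- phrase p, given processed prefix P = p₁⋯p_{i-1} and remainder R = p_i⋯p_z
LZPhrase : Word → Word → Word → Set
LZPhrase P p R =
    (∃ λ c → p ≡ [ c ] × ¬ (c ∈ P))
  ⊎ (p ≢ [] × Substring p P × (∀ q → Prefix q R → Substring q P → length q ≤ length p))

data LZFrom (P : Word) : List Word → Set where
  done : LZFrom P []
  step : ∀ {p ps} → LZPhrase P p (p ++ concat ps) → LZFrom (P ++ p) ps → LZFrom P (p ∷ ps)

IsLZFactorization : Word → List Word → Set
IsLZFactorization s ps = concat ps ≡ s × LZFrom [] ps

Bblock : ℕ → Word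
Bblock zero = [ b ]
Bblock (suc n) =
  concat (map (λ j → ([ a ] ^ʷ i) ++ [ b ] ++ ([ a ] ^ʷ j) ++ [ b ]) (map suc (upTo n)))
    ++ ([ a ] ^ʷ i) ++ [ b ]
  where i = suc n

sWord : ℕ → Word
sWord k = concat (map Bblock (upTo (suc k))) ++ [ a ]

-- A word a^{v₁} b ⋯ a^{vₙ} b a^t is handled through its run sequence (v₁ … vₙ ; t); the runs
-- of s_k are 0; 1; 2,1,2; 3,1,3,2,3; … ; 1.
--
-- Lyndon side: the pieces a^i b a^j b (0 < j < i) and a^i b of every B_i, followed by the final
-- a, are Lyndon words in strictly decreasing order, and a factorization of a word into a
-- non-increasing sequence of Lyndon words is unique, because its last factor is the least
-- nonempty suffix of the word. Hence m_k = 2 + Σ_{i=1}^{k} i.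
--
-- LZ side: a^u b a^{m₁} b ⋯ a^{m_r} b a^t occurs in a run-encoded word exactly when the run
-- sequence has an entry x ≥ u followed by m₁ … m_r and then by a run of length ≥ t. This
-- decides every occurrence question in the greedy parse: after b, a, ba, aba, baaba, the block
-- for h = 2, …, k−1 consists of the h phrases a^h b a b a^h, a b a^j b a^h (2 ≤ j < h) and
-- a b a^h b a^{h+1} b a. Greedy parsing is deterministic, so z_k = 5 + Σ_{h=2}^{k−1} h.
-- Thus m_k − z_k = k − 2, and z_k is quadratic in k.
module Submission where

open import Defs
open import Data.Nat using (ℕ; zero; suc; _+_; _*_; _∸_; _≤_; _<_; z≤n; s≤s; _≤?_)
open import Data.Nat.Properties
open import Data.List using (List; []; _∷_; _++_; [_]; concat; map; replicate; length; upTo; drop; applyUpTo; initLast; _∷ʳ′_)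
open import Data.List.Properties
open import Data.List.Relation.Unary.All using (All; []; _∷_)
import Data.List.Relation.Unary.All as All
open import Data.List.Relation.Unary.All.Properties using (++⁺; ++⁻ʳ; ∷ʳ⁻; replicate⁺) renaming (map⁺ to All-map⁺)
open import Data.List.Relation.Unary.Linked using (Linked; []; [-]; _∷_)
import Data.List.Relation.Unary.Linked as Linked
open import Data.List.Relation.Unary.Linked.Properties using (Linked⇒AllPairs) renaming (map⁺ to Linked-map⁺)
open import Data.List.Relation.Unary.AllPairs using (AllPairs; _∷_)
open import Data.List.Membership.Propositional using (_∈_)
open import Data.List.Membership.Propositional.Properties using (∈-++⁺ʳ)
open import Data.List.Relation.Unary.Any using (here; there)
open import Data.Product using (Σ; ∃; _×_; _,_; proj₁; proj₂)
open import Data.Sum using (_⊎_; inj₁; inj₂)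
open import Data.Empty using (⊥; ⊥-elim)
open import Data.Unit using (⊤; tt)
open import Relation.Nullary using (¬_; yes; no)
open import Relation.Binary.PropositionalEquality hiding ([_])
open import Data.Nat.Tactic.RingSolver using (solve-∀)
open ≡-Reasoning

-- Run-length encoding

aRun : ℕ → Word
aRun n = [ a ] ^ʷ n

bRuns : List ℕ → Word
bRuns [] = []
bRuns (v ∷ vs) = aRun v ++ b ∷ bRuns vs

aRun-+ : ∀ m n → aRun (m + n) ≡ aRun m ++ aRun n
aRun-+ zero n = refl
aRun-+ (suc m) n = cong (a ∷_) (aRun-+ m n)

aRun-∷ʳ : ∀ n → aRun n ++ [ a ] ≡ aRun (suc n)
aRun-∷ʳ zero = refl
aRun-∷ʳ (suc n) = cong (a ∷_) (aRun-∷ʳ n)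

length-aRun : ∀ n → length (aRun n) ≡ n
length-aRun zero = refl
length-aRun (suc n) = cong suc (length-aRun n)

bRuns-++ : ∀ vs ws → bRuns (vs ++ ws) ≡ bRuns vs ++ bRuns ws
bRuns-++ [] ws = refl
bRuns-++ (v ∷ vs) ws = trans (cong (λ w → aRun v ++ b ∷ w) (bRuns-++ vs ws))
                             (sym (++-assoc (aRun v) (b ∷ bRuns vs) (bRuns ws)))

bRuns-∷-++ : ∀ v vs w → bRuns (v ∷ vs) ++ w ≡ aRun v ++ b ∷ (bRuns vs ++ w)
bRuns-∷-++ v vs w = ++-assoc (aRun v) (b ∷ bRuns vs) w

aRun-b-nonempty : ∀ n w → aRun n ++ b ∷ w ≢ []
aRun-b-nonempty n w e with ++-conicalʳ (aRun n) (b ∷ w) e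
... | ()

aRun-b≢aRun : ∀ m n w → aRun m ++ b ∷ w ≢ aRun n
aRun-b≢aRun zero zero w ()
aRun-b≢aRun zero (suc n) w ()
aRun-b≢aRun (suc m) zero w ()
aRun-b≢aRun (suc m) (suc n) w eq = aRun-b≢aRun m n w (∷-injectiveʳ eq)

aRun-b-injective : ∀ m n w w′ → aRun m ++ b ∷ w ≡ aRun n ++ b ∷ w′ → m ≡ n × w ≡ w′
aRun-b-injective zero zero w w′ eq = refl , ∷-injectiveʳ eq
aRun-b-injective zero (suc n) w w′ ()
aRun-b-injective (suc m) zero w w′ ()
aRun-b-injective (suc m) (suc n) w w′ eq with aRun-b-injective m n w w′ (∷-injectiveʳ eq)
... | refl , e = refl , e

aRun-or-aRun-b : ∀ w → (∃ λ m → w ≡ aRun m) ⊎ (Σ ℕ λ m → Σ Word λ w′ → w ≡ aRun m ++ b ∷ w′)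
aRun-or-aRun-b [] = inj₁ (0 , refl)
aRun-or-aRun-b (b ∷ w) = inj₂ (0 , w , refl)
aRun-or-aRun-b (a ∷ w) with aRun-or-aRun-b w
... | inj₁ (m , e) = inj₁ (suc m , cong (a ∷_) e)
... | inj₂ (m , w′ , e) = inj₂ (suc m , w′ , cong (a ∷_) e)

runs-++ : ∀ vs t y ys t′ →
  (bRuns vs ++ aRun t) ++ (bRuns (y ∷ ys) ++ aRun t′) ≡ bRuns (vs ++ (t + y) ∷ ys) ++ aRun t′
runs-++ vs t y ys t′ = begin
  (bRuns vs ++ aRun t) ++ (bRuns (y ∷ ys) ++ aRun t′)
    ≡⟨ ++-assoc (bRuns vs) (aRun t) _ ⟩
  bRuns vs ++ (aRun t ++ (bRuns (y ∷ ys) ++ aRun t′))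
    ≡⟨ cong (λ w → bRuns vs ++ (aRun t ++ w)) (bRuns-∷-++ y ys (aRun t′)) ⟩
  bRuns vs ++ (aRun t ++ aRun y ++ b ∷ (bRuns ys ++ aRun t′))
    ≡⟨ cong (bRuns vs ++_) (sym (++-assoc (aRun t) (aRun y) _)) ⟩
  bRuns vs ++ ((aRun t ++ aRun y) ++ b ∷ (bRuns ys ++ aRun t′))
    ≡⟨ cong (λ w → bRuns vs ++ (w ++ b ∷ (bRuns ys ++ aRun t′))) (sym (aRun-+ t y)) ⟩
  bRuns vs ++ (aRun (t + y) ++ b ∷ (bRuns ys ++ aRun t′))
    ≡⟨ cong (bRuns vs ++_) (sym (bRuns-∷-++ (t + y) ys (aRun t′))) ⟩
  bRuns vs ++ (bRuns ((t + y) ∷ ys) ++ aRun t′)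
    ≡⟨ sym (++-assoc (bRuns vs) _ (aRun t′)) ⟩
  (bRuns vs ++ bRuns ((t + y) ∷ ys)) ++ aRun t′
    ≡⟨ cong (_++ aRun t′) (sym (bRuns-++ vs ((t + y) ∷ ys))) ⟩
  bRuns (vs ++ (t + y) ∷ ys) ++ aRun t′ ∎

runs-∷ʳ : ∀ vs t → (bRuns vs ++ aRun t) ++ [ a ] ≡ bRuns vs ++ aRun (suc t)
runs-∷ʳ vs t = trans (++-assoc (bRuns vs) (aRun t) [ a ]) (cong (bRuns vs ++_) (aRun-∷ʳ t))

-- Occurrences in run-encoded words

nextRun : List ℕ → ℕ → ℕ
nextRun [] t = t
nextRun (y ∷ _) _ = y

RunEmbedding : ℕ → List ℕ → ℕ → List ℕ → ℕ → Set
RunEmbedding u mid t vs tv = Σ (List ℕ) λ xs → Σ ℕ λ x → Σ (List ℕ) λ ys →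
  vs ≡ xs ++ x ∷ mid ++ ys × u ≤ x × t ≤ nextRun ys tv

locate-first-run : ∀ X n Z vs tv → X ++ aRun n ++ b ∷ Z ≡ bRuns vs ++ aRun tv →
  Σ (List ℕ) λ xs → Σ ℕ λ x → Σ (List ℕ) λ ys → vs ≡ xs ++ x ∷ ys × n ≤ x × Z ≡ bRuns ys ++ aRun tv
locate-first-run X n Z vs tv eq with aRun-or-aRun-b X
locate-first-run _ n Z [] tv eq | inj₁ (m , refl) =
  ⊥-elim (aRun-b≢aRun (m + n) tv Z (trans (cong (_++ b ∷ Z) (aRun-+ m n)) (trans (++-assoc (aRun m) _ _) eq)))
locate-first-run _ n Z (v ∷ vs) tv eq | inj₁ (m , refl)
  with aRun-b-injective (m + n) v Z (bRuns vs ++ aRun tv)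
         (trans (cong (_++ b ∷ Z) (aRun-+ m n)) (trans (++-assoc (aRun m) _ _) (trans eq (bRuns-∷-++ v vs (aRun tv)))))
... | refl , e = [] , m + n , vs , refl , m≤n+m n m , e
locate-first-run _ n Z [] tv eq | inj₂ (m , X′ , refl) =
  ⊥-elim (aRun-b≢aRun m tv _ (trans (sym (++-assoc (aRun m) (b ∷ X′) _)) eq))
locate-first-run _ n Z (v ∷ vs) tv eq | inj₂ (m , X′ , refl)
  with aRun-b-injective m v (X′ ++ aRun n ++ b ∷ Z) (bRuns vs ++ aRun tv)
         (trans (sym (++-assoc (aRun m) (b ∷ X′) _)) (trans eq (bRuns-∷-++ v vs (aRun tv))))
... | refl , e with locate-first-run X′ n Z vs tv e
... | xs , x , ys , refl , n≤x , e′ = v ∷ xs , x , ys , refl , n≤x , e′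

strip-runs : ∀ mid w ys tv → bRuns mid ++ w ≡ bRuns ys ++ aRun tv →
  Σ (List ℕ) λ ys′ → ys ≡ mid ++ ys′ × w ≡ bRuns ys′ ++ aRun tv
strip-runs [] w ys tv eq = ys , refl , eq
strip-runs (m ∷ mid) w [] tv eq = ⊥-elim (aRun-b≢aRun m tv _ (trans (sym (bRuns-∷-++ m mid w)) eq))
strip-runs (m ∷ mid) w (y ∷ ys) tv eq
  with aRun-b-injective m y (bRuns mid ++ w) (bRuns ys ++ aRun tv)
         (trans (sym (bRuns-∷-++ m mid w)) (trans eq (bRuns-∷-++ y ys (aRun tv))))
... | refl , e with strip-runs mid w ys tv e
... | ys′ , refl , e′ = ys′ , refl , e′

aRun-prefix≤nextRun : ∀ t w ys tv → aRun t ++ w ≡ bRuns ys ++ aRun tv → t ≤ nextRun ys tv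
aRun-prefix≤nextRun t w [] tv eq =
  subst₂ _≤_ (length-aRun t) (trans (cong length eq) (length-aRun tv)) (length-++-≤ˡ (aRun t))
aRun-prefix≤nextRun t w (y ∷ ys) tv eq = run-prefix t y (trans eq (bRuns-∷-++ y ys (aRun tv)))
  where
  run-prefix : ∀ t y {w w′} → aRun t ++ w ≡ aRun y ++ b ∷ w′ → t ≤ y
  run-prefix zero y eq = z≤n
  run-prefix (suc t) zero ()
  run-prefix (suc t) (suc y) eq = s≤s (run-prefix t y (∷-injectiveʳ eq))

Substring⇒RunEmbedding : ∀ u mid t vs tv →
  Substring (bRuns (u ∷ mid) ++ aRun t) (bRuns vs ++ aRun tv) → RunEmbedding u mid t vs tv
Substring⇒RunEmbedding u mid t vs tv (X , Y , eq)
  with locate-first-run X u (bRuns mid ++ aRun t ++ Y) vs tv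
         (trans (cong (X ++_) (sym (trans (++-assoc (bRuns (u ∷ mid)) (aRun t) Y) (bRuns-∷-++ u mid _)))) eq)
... | xs , x , ys , refl , u≤x , e with strip-runs mid (aRun t ++ Y) ys tv e
... | ys′ , refl , e′ = xs , x , ys′ , refl , u≤x , aRun-prefix≤nextRun t Y ys′ tv e′

nextRun-remainder : ∀ t ys tv → t ≤ nextRun ys tv → Σ Word λ w → aRun t ++ w ≡ bRuns ys ++ aRun tv
nextRun-remainder t [] tv t≤ = aRun (tv ∸ t) , trans (sym (aRun-+ t (tv ∸ t))) (cong aRun (m+[n∸m]≡n t≤))
nextRun-remainder t (y ∷ ys) tv t≤ = aRun (y ∸ t) ++ b ∷ (bRuns ys ++ aRun tv) , (begin
  aRun t ++ aRun (y ∸ t) ++ b ∷ (bRuns ys ++ aRun tv)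
    ≡⟨ sym (++-assoc (aRun t) (aRun (y ∸ t)) _) ⟩
  (aRun t ++ aRun (y ∸ t)) ++ b ∷ (bRuns ys ++ aRun tv)
    ≡⟨ cong (_++ b ∷ (bRuns ys ++ aRun tv)) (sym (aRun-+ t (y ∸ t))) ⟩
  aRun (t + (y ∸ t)) ++ b ∷ (bRuns ys ++ aRun tv)
    ≡⟨ cong (λ n → aRun n ++ b ∷ (bRuns ys ++ aRun tv)) (m+[n∸m]≡n t≤) ⟩
  aRun y ++ b ∷ (bRuns ys ++ aRun tv)
    ≡⟨ sym (bRuns-∷-++ y ys (aRun tv)) ⟩
  bRuns (y ∷ ys) ++ aRun tv ∎)

RunEmbedding⇒Substring : ∀ u mid t vs tv →
  RunEmbedding u mid t vs tv → Substring (bRuns (u ∷ mid) ++ aRun t) (bRuns vs ++ aRun tv)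
RunEmbedding⇒Substring u mid t _ tv (xs , x , ys , refl , u≤x , t≤) with nextRun-remainder t ys tv t≤
... | Y , eY = bRuns xs ++ aRun d , Y , (begin
  (bRuns xs ++ aRun d) ++ (bRuns (u ∷ mid) ++ aRun t) ++ Y
    ≡⟨ ++-assoc (bRuns xs) (aRun d) _ ⟩
  bRuns xs ++ aRun d ++ (bRuns (u ∷ mid) ++ aRun t) ++ Y
    ≡⟨ cong (λ w → bRuns xs ++ aRun d ++ w) (trans (++-assoc (bRuns (u ∷ mid)) (aRun t) Y) (bRuns-∷-++ u mid _)) ⟩
  bRuns xs ++ aRun d ++ aRun u ++ b ∷ (bRuns mid ++ aRun t ++ Y)
    ≡⟨ cong (bRuns xs ++_) (sym (++-assoc (aRun d) (aRun u) _)) ⟩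
  bRuns xs ++ (aRun d ++ aRun u) ++ b ∷ (bRuns mid ++ aRun t ++ Y)
    ≡⟨ cong₂ (λ w w′ → bRuns xs ++ w ++ b ∷ (bRuns mid ++ w′)) d+u eY ⟩
  bRuns xs ++ aRun x ++ b ∷ (bRuns mid ++ bRuns ys ++ aRun tv)
    ≡⟨ cong (λ w → bRuns xs ++ aRun x ++ b ∷ w) (sym (++-assoc (bRuns mid) (bRuns ys) (aRun tv))) ⟩
  bRuns xs ++ aRun x ++ b ∷ ((bRuns mid ++ bRuns ys) ++ aRun tv)
    ≡⟨ cong (bRuns xs ++_) (trans (cong (λ w → aRun x ++ b ∷ (w ++ aRun tv)) (sym (bRuns-++ mid ys)))
                                   (sym (bRuns-∷-++ x (mid ++ ys) (aRun tv)))) ⟩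
  bRuns xs ++ bRuns (x ∷ mid ++ ys) ++ aRun tv
    ≡⟨ sym (++-assoc (bRuns xs) _ (aRun tv)) ⟩
  (bRuns xs ++ bRuns (x ∷ mid ++ ys)) ++ aRun tv
    ≡⟨ cong (_++ aRun tv) (sym (bRuns-++ xs (x ∷ mid ++ ys))) ⟩
  bRuns (xs ++ x ∷ mid ++ ys) ++ aRun tv ∎)
  where
  d : ℕ
  d = x ∸ u
  d+u : aRun d ++ aRun u ≡ aRun x
  d+u = trans (sym (aRun-+ d u)) (cong aRun (m∸n+n≡m u≤x))

-- Greedy LZ parsing

Substring⇒length≤ : ∀ {u v} → Substring u v → length u ≤ length v
Substring⇒length≤ {u} (x , y , refl) = ≤-trans (length-++-≤ˡ u) (length-++-≤ʳ (u ++ y) {x})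

Substring-equal-length : ∀ {u v} → Substring u v → length u ≡ length v → u ≡ v
Substring-equal-length {u} ([] , [] , e) _ = trans (sym (++-identityʳ u)) e
Substring-equal-length {u} ([] , _ ∷ _ , refl) l = ⊥-elim (m+1+n≢m (length u) (sym (trans l (length-++ u))))
Substring-equal-length {u} (_ ∷ xs , y , refl) l =
  ⊥-elim (<-irrefl l (s≤s (≤-trans (length-++-≤ˡ u {y}) (length-++-≤ʳ (u ++ y) {xs}))))

Prefix⇒Substring : ∀ {q q′ v} → Prefix q q′ → Substring q′ v → Substring q v
Prefix⇒Substring {q} (y , refl) (x , y′ , eq) = x , y ++ y′ , trans (cong (x ++_) (sym (++-assoc q y y′))) eq

Substring⇒head∈ : ∀ {c w v} → Substring (c ∷ w) v → c ∈ v
Substring⇒head∈ (x , _ , refl) = ∈-++⁺ʳ x (here refl)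

shorter-prefix : ∀ (q q′ : Word) {y y′ r} → q ++ y ≡ r → q′ ++ y′ ≡ r → length q ≤ length q′ → Prefix q q′
shorter-prefix [] q′ _ _ _ = q′ , refl
shorter-prefix (c ∷ q) [] _ _ ()
shorter-prefix (c ∷ q) (c′ ∷ q′) {r = []} () _ _
shorter-prefix (c ∷ q) (c′ ∷ q′) {r = _ ∷ _} e e′ (s≤s le) with ∷-injective e | ∷-injective e′
... | refl , e₁ | refl , e₁′ with shorter-prefix q q′ e₁ e₁′ le
... | w , ew = w , cong (c ∷_) ew

equal-length-prefixes : ∀ (q q′ : Word) {y y′} → q ++ y ≡ q′ ++ y′ → length q ≡ length q′ → q ≡ q′
equal-length-prefixes [] [] _ _ = refl
equal-length-prefixes [] (_ ∷ _) _ ()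
equal-length-prefixes (_ ∷ _) [] _ ()
equal-length-prefixes (c ∷ q) (_ ∷ q′) e l with ∷-injective e
... | refl , e′ = cong (c ∷_) (equal-length-prefixes q q′ e′ (suc-injective l))

-- Substrings are closed under prefixes, so it suffices that p cannot be extended by the next letter.
maximal-phrase : ∀ P p r → p ≢ [] → Substring p P →
  (r ≡ [] ⊎ (Σ Letter λ c → Σ Word λ w → r ≡ c ∷ w × ¬ Substring (p ++ [ c ]) P)) →
  LZPhrase P p (p ++ r)
maximal-phrase P p r p≢[] p⊑P r-end = inj₂ (p≢[] , p⊑P , longest r-end)
  where
  longest : (r ≡ [] ⊎ (Σ Letter λ c → Σ Word λ w → r ≡ c ∷ w × ¬ Substring (p ++ [ c ]) P)) →
            ∀ q → Prefix q (p ++ r) → Substring q P → length q ≤ length p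
  longest (inj₁ refl) q (y , qy) _ = subst (length q ≤_) (trans (cong length qy) (cong length (++-identityʳ p))) (length-++-≤ˡ q)
  longest (inj₂ (c , w , refl , pc⋢P)) q (y , qy) q⊑P with length q ≤? length p
  ... | yes q≤p = q≤p
  ... | no q≰p = ⊥-elim (pc⋢P (Prefix⇒Substring pc≼q q⊑P))
    where
    pc≼q : Prefix (p ++ [ c ]) q
    pc≼q = shorter-prefix (p ++ [ c ]) q {y = w} (++-assoc p [ c ] w) qy
             (subst (_≤ length q) (sym (trans (length-++ p) (+-comm (length p) 1))) (≰⇒> q≰p))

LZPhrase-nonempty : ∀ {P p r} → LZPhrase P p r → p ≢ []
LZPhrase-nonempty (inj₁ (c , refl , _)) ()
LZPhrase-nonempty (inj₂ (p≢[] , _)) = p≢[]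

LZPhrase-unique : ∀ P p p′ r r′ → LZPhrase P p (p ++ r) → LZPhrase P p′ (p′ ++ r′) → p ++ r ≡ p′ ++ r′ → p ≡ p′
LZPhrase-unique P _ _ r r′ (inj₁ (c , refl , _)) (inj₁ (c′ , refl , _)) e with ∷-injective e
... | refl , _ = refl
LZPhrase-unique P _ [] r r′ (inj₁ _) (inj₂ (p′≢[] , _)) e = ⊥-elim (p′≢[] refl)
LZPhrase-unique P _ (c′ ∷ w) r r′ (inj₁ (c , refl , c∉P)) (inj₂ (_ , p′⊑P , _)) e with ∷-injective e
... | refl , _ = ⊥-elim (c∉P (Substring⇒head∈ p′⊑P))
LZPhrase-unique P [] _ r r′ (inj₂ (p≢[] , _)) (inj₁ _) e = ⊥-elim (p≢[] refl)
LZPhrase-unique P (c′ ∷ w) _ r r′ (inj₂ (_ , p⊑P , _)) (inj₁ (c , refl , c∉P)) e with ∷-injective e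
... | refl , _ = ⊥-elim (c∉P (Substring⇒head∈ p⊑P))
LZPhrase-unique P p p′ r r′ (inj₂ (_ , p⊑P , p-longest)) (inj₂ (_ , p′⊑P , p′-longest)) e =
  equal-length-prefixes p p′ e (≤-antisym (p′-longest p (r , e) p⊑P) (p-longest p′ (r′ , sym e) p′⊑P))

LZFrom-length-unique : ∀ {P ps ps′} → LZFrom P ps → LZFrom P ps′ → concat ps ≡ concat ps′ → length ps ≡ length ps′
LZFrom-length-unique done done e = refl
LZFrom-length-unique done (step {p} {ps} ph _) e = ⊥-elim (LZPhrase-nonempty ph (++-conicalˡ p (concat ps) (sym e)))
LZFrom-length-unique (step {p} {ps} ph _) done e = ⊥-elim (LZPhrase-nonempty ph (++-conicalˡ p (concat ps) e))
LZFrom-length-unique {P} (step {p} {ps} ph r) (step {p′} {ps′} ph′ r′) e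
  with LZPhrase-unique P p p′ (concat ps) (concat ps′) ph ph′ e
... | refl = cong suc (LZFrom-length-unique r r′ (++-cancelˡ p _ _ e))

module _ {X : Set} where

  data Chain (R : X → X → Set) : List X → X → Set where
    end  : ∀ x → Chain R (x ∷ []) x
    link : ∀ {x y ys l} → R x y → Chain R (y ∷ ys) l → Chain R (x ∷ y ∷ ys) l

  lastOf : X → List X → X
  lastOf x [] = x
  lastOf x (y ∷ ys) = lastOf y ys

  lastOf-++ : ∀ x xs y ys → lastOf x (xs ++ y ∷ ys) ≡ lastOf y ys
  lastOf-++ x [] y ys = refl
  lastOf-++ x (z ∷ xs) y ys = lastOf-++ z xs y ys

  lastOf-∷ʳ : ∀ x xs ys y → x ∷ xs ≡ ys ++ y ∷ [] → lastOf x xs ≡ y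
  lastOf-∷ʳ x xs [] y refl = refl
  lastOf-∷ʳ x xs (z ∷ ys) y e with ∷-injective e
  ... | refl , e′ = trans (cong (lastOf x) e′) (lastOf-++ x ys y [])

  Chain-resp : ∀ {R xs ys l} → xs ≡ ys → Chain R xs l → Chain R ys l
  Chain-resp {R} {l = l} = subst (λ zs → Chain R zs l)

  Chain-++ : ∀ {R xs l y ys l′} → Chain R xs l → R l y → Chain R (y ∷ ys) l′ → Chain R (xs ++ y ∷ ys) l′
  Chain-++ (end x) r q = link r q
  Chain-++ (link r′ p) r q = link r′ (Chain-++ p r q)

  Chain-∷ʳ : ∀ {R xs l y} → Chain R xs l → R l y → Chain R (xs ++ y ∷ []) y
  Chain-∷ʳ p r = Chain-++ p r (end _)

  Chain-adjacent : ∀ {R vs l} xs {x y ys} → Chain R vs l → vs ≡ xs ++ x ∷ y ∷ ys → R x y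
  Chain-adjacent [] (link r _) refl = r
  Chain-adjacent (_ ∷ xs) (link r p) e = Chain-adjacent xs p (∷-injectiveʳ e)
  Chain-adjacent [] (end _) ()
  Chain-adjacent (_ ∷ []) (end _) ()
  Chain-adjacent (_ ∷ _ ∷ _) (end _) ()

  unrelated-pair-at-junction : ∀ {R vs l y₀ ws l′} xs {x y ys} → Chain R vs l → Chain R (y₀ ∷ ws) l′ →
    vs ++ y₀ ∷ ws ≡ xs ++ x ∷ y ∷ ys → ¬ R x y → ys ≡ ws
  unrelated-pair-at-junction [] (end _) q refl ¬r = refl
  unrelated-pair-at-junction (_ ∷ xs) (end _) q e ¬r = ⊥-elim (¬r (Chain-adjacent xs q (∷-injectiveʳ e)))
  unrelated-pair-at-junction [] (link r _) q refl ¬r = ⊥-elim (¬r r)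
  unrelated-pair-at-junction (_ ∷ xs) (link r p) q e ¬r = unrelated-pair-at-junction xs p q (∷-injectiveʳ e) ¬r

  Chain⇒Linked : ∀ {R xs l} → Chain R xs l → Linked R xs
  Chain⇒Linked (end x) = [-]
  Chain⇒Linked (link r (end x)) = r ∷ [-]
  Chain⇒Linked (link r (link r′ p)) = r ∷ Chain⇒Linked (link r′ p)

  Chain-from-All : ∀ {R : X → X → Set} {P Q : X → Set} → (∀ {x y} → P x → Q y → R x y) →
    ∀ x xs → All P (x ∷ xs) → All Q xs → Chain R (x ∷ xs) (lastOf x xs)
  Chain-from-All f x [] _ _ = end x
  Chain-from-All f x (y ∷ xs) (px ∷ ps) (qy ∷ qs) = link (f px qy) (Chain-from-All f y xs ps qs)

pairRuns : ℕ → ℕ → List ℕ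
pairRuns i t = concat (map (λ j → i ∷ j ∷ []) (map suc (upTo t)))

blockRuns : ℕ → List ℕ
blockRuns zero = 0 ∷ []
blockRuns (suc n) = pairRuns (suc n) n ++ suc n ∷ []

sRuns : ℕ → List ℕ
sRuns k = concat (map blockRuns (upTo (suc k)))

sRunWord : ℕ → Word
sRunWord k = bRuns (sRuns k) ++ aRun 1

upTo-suc : ∀ n → upTo (suc n) ≡ upTo n ++ n ∷ []
upTo-suc n = sym (upTo-∷ʳ n)

map-suc-upTo-suc : ∀ t → map suc (upTo (suc t)) ≡ map suc (upTo t) ++ suc t ∷ []
map-suc-upTo-suc t = trans (cong (map suc) (upTo-suc t)) (map-++ suc (upTo t) (t ∷ []))

pairRuns-suc : ∀ i t → pairRuns i (suc t) ≡ pairRuns i t ++ i ∷ suc t ∷ []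
pairRuns-suc i t = begin
  concat (map pair (map suc (upTo (suc t))))
    ≡⟨ cong (λ js → concat (map pair js)) (map-suc-upTo-suc t) ⟩
  concat (map pair (map suc (upTo t) ++ suc t ∷ []))
    ≡⟨ cong concat (map-++ pair (map suc (upTo t)) (suc t ∷ [])) ⟩
  concat (map pair (map suc (upTo t)) ++ pair (suc t) ∷ [])
    ≡⟨ sym (concat-++ (map pair (map suc (upTo t))) (pair (suc t) ∷ [])) ⟩
  pairRuns i t ++ i ∷ suc t ∷ [] ∎
  where
  pair : ℕ → List ℕ
  pair j = i ∷ j ∷ []

sRuns-suc : ∀ k → sRuns (suc k) ≡ sRuns k ++ blockRuns (suc k)
sRuns-suc k = begin
  concat (map blockRuns (upTo (suc (suc k))))
    ≡⟨ cong (λ js → concat (map blockRuns js)) (upTo-suc (suc k)) ⟩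
  concat (map blockRuns (upTo (suc k) ++ suc k ∷ []))
    ≡⟨ cong concat (map-++ blockRuns (upTo (suc k)) (suc k ∷ [])) ⟩
  concat (map blockRuns (upTo (suc k)) ++ blockRuns (suc k) ∷ [])
    ≡⟨ sym (concat-++ (map blockRuns (upTo (suc k))) (blockRuns (suc k) ∷ [])) ⟩
  sRuns k ++ blockRuns (suc k) ++ []
    ≡⟨ cong (sRuns k ++_) (++-identityʳ (blockRuns (suc k))) ⟩
  sRuns k ++ blockRuns (suc k) ∎

Bblock≡bRuns : ∀ i → Bblock i ≡ bRuns (blockRuns i)
Bblock≡bRuns zero = refl
Bblock≡bRuns (suc n) = sym (trans (bRuns-++ (pairRuns (suc n) n) (suc n ∷ []))
                                  (cong (_++ bRuns (suc n ∷ [])) (pairs (map suc (upTo n)))))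
  where
  pairs : ∀ js → bRuns (concat (map (λ j → suc n ∷ j ∷ []) js))
                 ≡ concat (map (λ j → aRun (suc n) ++ [ b ] ++ aRun j ++ [ b ]) js)
  pairs [] = refl
  pairs (j ∷ js) = trans (bRuns-++ (suc n ∷ j ∷ []) (concat (map (λ j → suc n ∷ j ∷ []) js))) (cong (bRuns (suc n ∷ j ∷ []) ++_) (pairs js))

sWord≡sRunWord : ∀ k → sWord k ≡ sRunWord k
sWord≡sRunWord k = cong (_++ [ a ]) (blocks (upTo (suc k)))
  where
  blocks : ∀ is → concat (map Bblock is) ≡ bRuns (concat (map blockRuns is))
  blocks [] = refl
  blocks (i ∷ is) = trans (cong₂ _++_ (Bblock≡bRuns i) (blocks is)) (sym (bRuns-++ (blockRuns i) _))

pairRuns-entries : ∀ i t → All (λ x → x ≡ i ⊎ (1 ≤ x × x ≤ t)) (pairRuns i t)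
pairRuns-entries i zero = []
pairRuns-entries i (suc t) = subst (All _) (sym (pairRuns-suc i t))
  (++⁺ (All.map (λ { (inj₁ e) → inj₁ e ; (inj₂ (l , u)) → inj₂ (l , m≤n⇒m≤1+n u) }) (pairRuns-entries i t))
       (inj₁ refl ∷ inj₂ (s≤s z≤n , ≤-refl) ∷ []))

blockRuns-bounded : ∀ i → All (_≤ i) (blockRuns i)
blockRuns-bounded zero = z≤n ∷ []
blockRuns-bounded (suc n) =
  ++⁺ (All.map (λ { (inj₁ refl) → ≤-refl ; (inj₂ (_ , u)) → m≤n⇒m≤1+n u }) (pairRuns-entries (suc n) n)) (≤-refl ∷ [])

sRuns-bounded : ∀ k → All (_≤ k) (sRuns k)
sRuns-bounded zero = z≤n ∷ []
sRuns-bounded (suc k) = subst (All (_≤ suc k)) (sym (sRuns-suc k))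
  (++⁺ (All.map m≤n⇒m≤1+n (sRuns-bounded k)) (blockRuns-bounded (suc k)))

sRuns-last : ∀ k → sRuns (suc k) ≡ (sRuns k ++ pairRuns (suc k) k) ++ suc k ∷ []
sRuns-last k = trans (sRuns-suc k) (sym (++-assoc (sRuns k) (pairRuns (suc k) k) (suc k ∷ [])))

Chain-sRuns : ∀ {R : ℕ → ℕ → Set} k → (∀ {x y} → y ≤ suc k → R x y) → Chain R (sRuns (suc k)) (suc k)
Chain-sRuns {R} k f with sRuns (suc k) | sRuns-bounded (suc k) | sRuns-last k
... | x ∷ xs | _ ∷ bs | e = subst (Chain R (x ∷ xs)) (lastOf-∷ʳ x xs (sRuns k ++ pairRuns (suc k) k) (suc k) e)
  (Chain-from-All {P = λ _ → ⊤} (λ _ → f) x xs (All.universal (λ _ → tt) (x ∷ xs)) bs)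
... | [] | _ | e with ++-conicalʳ (sRuns k ++ pairRuns (suc k) k) (suc k ∷ []) (sym e)
...   | ()

openingPhrase : ℕ → Word
openingPhrase h = bRuns (h ∷ 1 ∷ []) ++ aRun h

middlePhrase : ℕ → ℕ → Word
middlePhrase h j = bRuns (1 ∷ j ∷ []) ++ aRun h

closingPhrase : ℕ → Word
closingPhrase h = bRuns (1 ∷ h ∷ suc h ∷ []) ++ aRun 1

-- The prefix of s_{h+1} that ends just after a^{h+1} b a^t b a^h.
parsed : ℕ → ℕ → Word
parsed h t = bRuns (sRuns h ++ pairRuns (suc h) t) ++ aRun h

Substring-runs-∷ʳ : ∀ vs t {w} → Substring ((bRuns vs ++ aRun t) ++ [ a ]) w → Substring (bRuns vs ++ aRun (suc t)) w
Substring-runs-∷ʳ vs t {w} = subst (λ u → Substring u w) (runs-∷ʳ vs t)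

nextRun-bounded : ∀ {P : ℕ → Set} xs x mid ys tv → All P (xs ++ x ∷ mid ++ ys) → P tv → P (nextRun ys tv)
nextRun-bounded xs x mid [] tv _ ptv = ptv
nextRun-bounded xs x mid (y ∷ ys) tv all _ with ++⁻ʳ mid (All.tail (++⁻ʳ xs all))
... | py ∷ _ = py

pairRuns-contains : ∀ i t j → 1 ≤ j → j ≤ t → Σ (List ℕ) λ X → Σ (List ℕ) λ Y → pairRuns i t ++ i ∷ [] ≡ X ++ i ∷ j ∷ i ∷ Y
pairRuns-contains i zero (suc j) _ ()
pairRuns-contains i (suc t) j 1≤j j≤1+t with m≤n⇒m<n∨m≡n j≤1+t
... | inj₂ refl = pairRuns i t , [] , last
  where
  last : pairRuns i (suc t) ++ i ∷ [] ≡ pairRuns i t ++ i ∷ suc t ∷ i ∷ []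
  last = trans (cong (_++ i ∷ []) (pairRuns-suc i t)) (++-assoc (pairRuns i t) (i ∷ suc t ∷ []) (i ∷ []))
... | inj₁ (s≤s j≤t) with pairRuns-contains i t j 1≤j j≤t
... | X , Y , e = X , Y ++ suc t ∷ i ∷ [] , (begin
  pairRuns i (suc t) ++ i ∷ []                ≡⟨ cong (_++ i ∷ []) (pairRuns-suc i t) ⟩
  (pairRuns i t ++ i ∷ suc t ∷ []) ++ i ∷ []  ≡⟨ ++-assoc (pairRuns i t) _ _ ⟩
  pairRuns i t ++ (i ∷ []) ++ suc t ∷ i ∷ []  ≡⟨ sym (++-assoc (pairRuns i t) (i ∷ []) _) ⟩
  (pairRuns i t ++ i ∷ []) ++ suc t ∷ i ∷ []  ≡⟨ cong (_++ suc t ∷ i ∷ []) e ⟩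
  (X ++ i ∷ j ∷ i ∷ Y) ++ suc t ∷ i ∷ []      ≡⟨ ++-assoc X (i ∷ j ∷ i ∷ Y) _ ⟩
  X ++ i ∷ j ∷ i ∷ Y ++ suc t ∷ i ∷ [] ∎)

module _ (n : ℕ) where
  private
    h : ℕ
    h = suc (suc n)

  opening-occurs : Substring (openingPhrase h) (sRunWord h)
  opening-occurs = RunEmbedding⇒Substring h (1 ∷ []) h (sRuns h) 1
    (sRuns (suc n) , h , _ , sRuns-suc (suc n) , ≤-refl , ≤-reflexive (next (map suc (applyUpTo suc n))))
    where
    next : ∀ js → h ≡ nextRun (concat (map (λ j → h ∷ j ∷ []) js) ++ h ∷ []) 1
    next [] = refl
    next (_ ∷ _) = refl

  opening-maximal : ¬ Substring (openingPhrase h ++ [ a ]) (sRunWord h)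
  opening-maximal occ with Substring⇒RunEmbedding h (1 ∷ []) (suc h) (sRuns h) 1
                             (Substring-runs-∷ʳ (h ∷ 1 ∷ []) h occ)
  ... | xs , x , ys , e , _ , h<next = <⇒≱ h<next
    (nextRun-bounded {_≤ h} xs x (1 ∷ []) ys 1 (subst (All (_≤ h)) e (sRuns-bounded h)) (s≤s z≤n))

module _ (h₁ t′ : ℕ) (j<h₁ : suc (suc t′) ≤ h₁) where
  private
    h t j : ℕ
    h = suc h₁
    t = suc t′
    j = suc t

  middle-occurs : Substring (middlePhrase h j) (parsed h t)
  middle-occurs with pairRuns-contains h h₁ j (s≤s z≤n) j<h₁
  ... | X , Y , e = RunEmbedding⇒Substring 1 (j ∷ []) h (sRuns h ++ pairRuns (suc h) t) h
    (sRuns h₁ ++ X , h , h ∷ Y ++ pairRuns (suc h) t , split , s≤s z≤n , ≤-refl)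
    where
    split : sRuns h ++ pairRuns (suc h) t ≡ (sRuns h₁ ++ X) ++ h ∷ (j ∷ []) ++ h ∷ Y ++ pairRuns (suc h) t
    split = begin
      sRuns h ++ pairRuns (suc h) t
        ≡⟨ cong (_++ pairRuns (suc h) t) (trans (sRuns-suc h₁) (cong (sRuns h₁ ++_) e)) ⟩
      (sRuns h₁ ++ X ++ h ∷ j ∷ h ∷ Y) ++ pairRuns (suc h) t
        ≡⟨ cong (_++ pairRuns (suc h) t) (sym (++-assoc (sRuns h₁) X _)) ⟩
      ((sRuns h₁ ++ X) ++ h ∷ j ∷ h ∷ Y) ++ pairRuns (suc h) t
        ≡⟨ ++-assoc (sRuns h₁ ++ X) _ _ ⟩
      (sRuns h₁ ++ X) ++ h ∷ j ∷ h ∷ Y ++ pairRuns (suc h) t ∎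

  -- A run of length j is followed by one of length at most h: inside sRuns h all runs are
  -- at most h, and j does not occur in pairRuns (suc h) t.
  middle-maximal : ¬ Substring (middlePhrase h j ++ [ a ]) (parsed h t)
  middle-maximal occ with Substring⇒RunEmbedding 1 (j ∷ []) (suc h) (sRuns h ++ pairRuns (suc h) t) h
                            (Substring-runs-∷ʳ (1 ∷ j ∷ []) h occ)
  ... | xs , x , [] , _ , _ , h<h = <-irrefl refl h<h
  ... | xs , x , y ∷ ys , e , _ , h<y = <⇒≱ h<y (Chain-adjacent (xs ++ x ∷ []) chain (trans e (sym (++-assoc xs (x ∷ []) _))) refl)
    where
    R : ℕ → ℕ → Set
    R u v = u ≡ j → v ≤ h
    j∉pairs : All (_≢ j) (pairRuns (suc h) t)
    j∉pairs = All.map (λ { (inj₁ refl) e → <-irrefl (sym e) (s≤s (m≤n⇒m≤1+n j<h₁))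
                         ; (inj₂ (_ , u)) refl → <-irrefl refl (≤-trans (s≤s ≤-refl) u) })
                      (pairRuns-entries (suc h) t)
    chain-pairs : Chain R (pairRuns (suc h) t) _
    chain-pairs with j∉pairs
    ... | p ∷ ps = Chain-from-All {Q = λ _ → ⊤} (λ u≢j _ u≡j → ⊥-elim (u≢j u≡j)) _ _ (p ∷ ps) (All.universal (λ _ → tt) _)
    chain : Chain R (sRuns h ++ pairRuns (suc h) t) _
    chain = Chain-++ (Chain-sRuns h₁ (λ v≤h _ → v≤h))
                     (λ { refl → ⊥-elim (<-irrefl refl (≤-trans (s≤s ≤-refl) j<h₁)) }) chain-pairs

module _ (h₂ : ℕ) where
  private
    h₁ h : ℕ
    h₁ = suc h₂
    h = suc h₁

  closing-occurs : Substring (closingPhrase h) (parsed h h₁)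
  closing-occurs = RunEmbedding⇒Substring 1 (h ∷ suc h ∷ []) 1 (sRuns h ++ G) h
    (sRuns h₁ ++ g ++ h ∷ [] , h₁ , _ , split , s≤s z≤n , s≤s z≤n)
    where
    G g : List ℕ
    G = pairRuns (suc h) h₁
    g = pairRuns h h₂
    split : sRuns h ++ G ≡ (sRuns h₁ ++ g ++ h ∷ []) ++ h₁ ∷ h ∷ G
    split = begin
      sRuns h ++ G
        ≡⟨ cong (_++ G) (sRuns-suc h₁) ⟩
      (sRuns h₁ ++ (pairRuns h h₁ ++ h ∷ [])) ++ G
        ≡⟨ cong (λ z → (sRuns h₁ ++ (z ++ h ∷ [])) ++ G) (pairRuns-suc h h₂) ⟩
      (sRuns h₁ ++ ((g ++ h ∷ h₁ ∷ []) ++ h ∷ [])) ++ G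
        ≡⟨ ++-assoc (sRuns h₁) _ G ⟩
      sRuns h₁ ++ (((g ++ h ∷ h₁ ∷ []) ++ h ∷ []) ++ G)
        ≡⟨ cong (sRuns h₁ ++_) (trans (++-assoc (g ++ h ∷ h₁ ∷ []) (h ∷ []) G) (++-assoc g (h ∷ h₁ ∷ []) (h ∷ G))) ⟩
      sRuns h₁ ++ (g ++ h ∷ h₁ ∷ h ∷ G)
        ≡⟨ cong (sRuns h₁ ++_) (sym (++-assoc g (h ∷ []) (h₁ ∷ h ∷ G))) ⟩
      sRuns h₁ ++ ((g ++ h ∷ []) ++ h₁ ∷ h ∷ G)
        ≡⟨ sym (++-assoc (sRuns h₁) (g ++ h ∷ []) _) ⟩
      (sRuns h₁ ++ g ++ h ∷ []) ++ h₁ ∷ h ∷ G ∎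

  -- The only h immediately followed by h + 1 is the last run of sRuns h, and the run after
  -- that h + 1 has length 1.
  closing-maximal : ¬ Substring (closingPhrase h ++ [ a ]) (parsed h h₁)
  closing-maximal occ with Substring⇒RunEmbedding 1 (h ∷ suc h ∷ []) 2 (sRuns h ++ pairRuns (suc h) h₁) h
                             (Substring-runs-∷ʳ (1 ∷ h ∷ suc h ∷ []) 1 occ)
  ... | xs , x , ys , e , _ , 2≤next = 2≰1 (subst (λ zs → 2 ≤ nextRun zs h) ys≡ 2≤next)
    where
    2≰1 : ¬ 2 ≤ 1
    2≰1 (s≤s ())
    R : ℕ → ℕ → Set
    R u v = u ≡ h → v ≢ suc h
    h∉pairs : All (_≢ h) (pairRuns (suc h) h₁)
    h∉pairs = All.map (λ { (inj₁ refl) e → <-irrefl (sym e) ≤-refl ; (inj₂ (_ , u)) refl → <-irrefl refl (s≤s u) })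
                      (pairRuns-entries (suc h) h₁)
    chain-pairs : Chain R (pairRuns (suc h) h₁) _
    chain-pairs with h∉pairs
    ... | p ∷ ps = Chain-from-All {Q = λ _ → ⊤} (λ u≢h _ u≡h → ⊥-elim (u≢h u≡h)) _ _ (p ∷ ps) (All.universal (λ _ → tt) _)
    chain-sRuns : Chain R (sRuns h) h
    chain-sRuns = Chain-sRuns h₁ (λ v≤h _ v≡1+h → <-irrefl refl (subst (_≤ h) v≡1+h v≤h))
    ys≡ : ys ≡ drop 1 (pairRuns (suc h) h₁)
    ys≡ = unrelated-pair-at-junction (xs ++ x ∷ []) chain-sRuns chain-pairs
            (trans e (sym (++-assoc xs (x ∷ []) _))) (λ r → r refl refl)

-- The LZ factorization of s_k

EmptyOrA : Word → Set
EmptyOrA w = w ≡ [] ⊎ ∃ λ v → w ≡ a ∷ v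

maximal-before-a : ∀ P p r → p ≢ [] → Substring p P → EmptyOrA r → ¬ Substring (p ++ [ a ]) P → LZPhrase P p (p ++ r)
maximal-before-a P p r p≢[] p⊑P (inj₁ r≡[]) _ = maximal-phrase P p r p≢[] p⊑P (inj₁ r≡[])
maximal-before-a P p r p≢[] p⊑P (inj₂ (v , r≡av)) pa⋢P = maximal-phrase P p r p≢[] p⊑P (inj₂ (a , v , r≡av , pa⋢P))

LZFrom-resp : ∀ {P Q ps} → P ≡ Q → LZFrom P ps → LZFrom Q ps
LZFrom-resp {ps = ps} = subst (λ P → LZFrom P ps)

opening-extends : ∀ h → sRunWord h ++ openingPhrase h ≡ parsed h 1
opening-extends h = runs-++ (sRuns h) 1 h (1 ∷ []) h

middle-extends : ∀ h t → parsed h t ++ middlePhrase h (suc t) ≡ parsed h (suc t)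
middle-extends h t = trans (runs-++ (sRuns h ++ pairRuns (suc h) t) h 1 (suc t ∷ []) h) (cong (λ z → bRuns z ++ aRun h) (begin
  (sRuns h ++ pairRuns (suc h) t) ++ (h + 1) ∷ suc t ∷ []
    ≡⟨ ++-assoc (sRuns h) _ _ ⟩
  sRuns h ++ pairRuns (suc h) t ++ (h + 1) ∷ suc t ∷ []
    ≡⟨ cong (λ z → sRuns h ++ pairRuns (suc h) t ++ z ∷ suc t ∷ []) (+-comm h 1) ⟩
  sRuns h ++ pairRuns (suc h) t ++ suc h ∷ suc t ∷ []
    ≡⟨ cong (sRuns h ++_) (sym (pairRuns-suc (suc h) t)) ⟩
  sRuns h ++ pairRuns (suc h) (suc t) ∎))

closing-extends : ∀ h₁ → parsed (suc h₁) h₁ ++ closingPhrase (suc h₁) ≡ sRunWord (suc (suc h₁))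
closing-extends h₁ = trans (runs-++ (sRuns h ++ G) h 1 (h ∷ suc h ∷ []) 1) (cong (λ z → bRuns z ++ aRun 1) (begin
  (sRuns h ++ G) ++ (h + 1) ∷ h ∷ suc h ∷ []
    ≡⟨ cong (λ z → (sRuns h ++ G) ++ z ∷ h ∷ suc h ∷ []) (+-comm h 1) ⟩
  (sRuns h ++ G) ++ suc h ∷ h ∷ suc h ∷ []
    ≡⟨ ++-assoc (sRuns h) G _ ⟩
  sRuns h ++ G ++ suc h ∷ h ∷ suc h ∷ []
    ≡⟨ cong (sRuns h ++_) (sym (++-assoc G (suc h ∷ h ∷ []) (suc h ∷ []))) ⟩
  sRuns h ++ (G ++ suc h ∷ h ∷ []) ++ suc h ∷ []
    ≡⟨ cong (λ z → sRuns h ++ z ++ suc h ∷ []) (sym (pairRuns-suc (suc h) h₁)) ⟩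
  sRuns h ++ blockRuns (suc h)
    ≡⟨ sym (sRuns-suc h) ⟩
  sRuns (suc h) ∎))
  where
  h : ℕ
  h = suc h₁
  G : List ℕ
  G = pairRuns (suc h) h₁

middlePhrases : ℕ → ℕ → ℕ → List Word
middlePhrases h t zero = []
middlePhrases h t (suc d) = middlePhrase h (suc t) ∷ middlePhrases h (suc t) d

concat-middlePhrases : ∀ h d t → parsed h t ++ concat (middlePhrases h t d) ≡ parsed h (t + d)
concat-middlePhrases h zero t = trans (++-identityʳ _) (cong (parsed h) (sym (+-identityʳ t)))
concat-middlePhrases h (suc d) t = begin
  parsed h t ++ middlePhrase h (suc t) ++ concat (middlePhrases h (suc t) d)
    ≡⟨ sym (++-assoc (parsed h t) _ _) ⟩
  (parsed h t ++ middlePhrase h (suc t)) ++ concat (middlePhrases h (suc t) d)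
    ≡⟨ cong (_++ concat (middlePhrases h (suc t) d)) (middle-extends h t) ⟩
  parsed h (suc t) ++ concat (middlePhrases h (suc t) d)
    ≡⟨ concat-middlePhrases h d (suc t) ⟩
  parsed h (suc t + d)
    ≡⟨ cong (parsed h) (sym (+-suc t d)) ⟩
  parsed h (t + suc d) ∎

middlePhrases-then-closing : ∀ h t d rest → EmptyOrA (concat (middlePhrases h t d ++ closingPhrase h ∷ rest))
middlePhrases-then-closing h t zero rest = inj₂ (_ , refl)
middlePhrases-then-closing h t (suc d) rest = inj₂ (_ , refl)

middlePhrases-LZ : ∀ h₁ rest d t → 1 ≤ t → t + d ≤ h₁ →
  LZFrom (parsed (suc h₁) (t + d)) (closingPhrase (suc h₁) ∷ rest) →
  LZFrom (parsed (suc h₁) t) (middlePhrases (suc h₁) t d ++ closingPhrase (suc h₁) ∷ rest)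
middlePhrases-LZ h₁ rest zero t _ _ lz = LZFrom-resp (cong (parsed (suc h₁)) (+-identityʳ t)) lz
middlePhrases-LZ h₁ rest (suc d) (suc t′) _ t+d≤h₁ lz =
  step (maximal-before-a _ _ _ (λ ()) (middle-occurs h₁ t′ j<h₁) (middlePhrases-then-closing _ _ d rest) (middle-maximal h₁ t′ j<h₁))
       (LZFrom-resp (sym (middle-extends (suc h₁) (suc t′)))
         (middlePhrases-LZ h₁ rest d (suc (suc t′)) (s≤s z≤n) (subst (_≤ h₁) (+-suc (suc t′) d) t+d≤h₁)
           (LZFrom-resp (cong (parsed (suc h₁)) (+-suc (suc t′) d)) lz)))
  where
  j<h₁ : suc (suc t′) ≤ h₁
  j<h₁ = ≤-trans (s≤s (s≤s (m≤m+n t′ d))) (subst (_≤ h₁) (cong suc (+-suc t′ d)) t+d≤h₁)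

blockPhrases : ℕ → List Word
blockPhrases n = openingPhrase h ∷ middlePhrases h 1 n ++ closingPhrase h ∷ []
  where
  h : ℕ
  h = suc (suc n)

concat-blockPhrases : ∀ n → sRunWord (suc (suc n)) ++ concat (blockPhrases n) ≡ sRunWord (suc (suc (suc n)))
concat-blockPhrases n = begin
  sRunWord h ++ openingPhrase h ++ concat (Ms ++ closingPhrase h ∷ [])
    ≡⟨ sym (++-assoc (sRunWord h) _ _) ⟩
  (sRunWord h ++ openingPhrase h) ++ concat (Ms ++ closingPhrase h ∷ [])
    ≡⟨ cong₂ _++_ (opening-extends h) (sym (concat-++ Ms (closingPhrase h ∷ []))) ⟩
  parsed h 1 ++ concat Ms ++ closingPhrase h ++ []
    ≡⟨ cong (λ z → parsed h 1 ++ concat Ms ++ z) (++-identityʳ (closingPhrase h)) ⟩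
  parsed h 1 ++ concat Ms ++ closingPhrase h
    ≡⟨ sym (++-assoc (parsed h 1) _ _) ⟩
  (parsed h 1 ++ concat Ms) ++ closingPhrase h
    ≡⟨ cong (_++ closingPhrase h) (concat-middlePhrases h n 1) ⟩
  parsed h (suc n) ++ closingPhrase h
    ≡⟨ closing-extends (suc n) ⟩
  sRunWord (suc h) ∎
  where
  h : ℕ
  h = suc (suc n)
  Ms : List Word
  Ms = middlePhrases h 1 n

block-LZ : ∀ n rest → EmptyOrA (concat rest) → LZFrom (sRunWord (suc (suc (suc n)))) rest →
  LZFrom (sRunWord (suc (suc n))) (blockPhrases n ++ rest)
block-LZ n rest rest-a lz =
  subst (LZFrom (sRunWord h)) (cong (openingPhrase h ∷_) (sym (++-assoc (middlePhrases h 1 n) (closingPhrase h ∷ []) rest)))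
   (step (maximal-before-a _ _ _ (λ ()) (opening-occurs n) (middlePhrases-then-closing h 1 n rest) (opening-maximal n))
   (LZFrom-resp (sym (opening-extends h))
   (middlePhrases-LZ (suc n) rest n 1 (s≤s z≤n) ≤-refl
   (step (maximal-before-a _ _ _ (λ ()) (closing-occurs n) rest-a (closing-maximal n))
   (LZFrom-resp (sym (closing-extends (suc n))) lz)))))
  where
  h : ℕ
  h = suc (suc n)

phrasesFrom : ℕ → ℕ → List Word
phrasesFrom n zero = []
phrasesFrom n (suc d) = blockPhrases n ++ phrasesFrom (suc n) d

phrasesFrom-EmptyOrA : ∀ d n → EmptyOrA (concat (phrasesFrom n d))
phrasesFrom-EmptyOrA zero n = inj₁ refl
phrasesFrom-EmptyOrA (suc d) n = inj₂ (_ , refl)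

phrasesFrom-LZ : ∀ d n → LZFrom (sRunWord (suc (suc n))) (phrasesFrom n d)
phrasesFrom-LZ zero n = done
phrasesFrom-LZ (suc d) n = block-LZ n (phrasesFrom (suc n) d) (phrasesFrom-EmptyOrA d (suc n)) (phrasesFrom-LZ d (suc n))

concat-phrasesFrom : ∀ d n → sRunWord (suc (suc n)) ++ concat (phrasesFrom n d) ≡ sRunWord (suc (suc (n + d)))
concat-phrasesFrom zero n = trans (++-identityʳ _) (cong (λ m → sRunWord (suc (suc m))) (sym (+-identityʳ n)))
concat-phrasesFrom (suc d) n = begin
  sRunWord (2 + n) ++ concat (blockPhrases n ++ phrasesFrom (suc n) d)
    ≡⟨ cong (sRunWord (2 + n) ++_) (sym (concat-++ (blockPhrases n) _)) ⟩
  sRunWord (2 + n) ++ concat (blockPhrases n) ++ concat (phrasesFrom (suc n) d)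
    ≡⟨ sym (++-assoc (sRunWord (2 + n)) _ _) ⟩
  (sRunWord (2 + n) ++ concat (blockPhrases n)) ++ concat (phrasesFrom (suc n) d)
    ≡⟨ cong (_++ concat (phrasesFrom (suc n) d)) (concat-blockPhrases n) ⟩
  sRunWord (3 + n) ++ concat (phrasesFrom (suc n) d)
    ≡⟨ concat-phrasesFrom d (suc n) ⟩
  sRunWord (2 + (suc n + d))
    ≡⟨ cong (λ m → sRunWord (2 + m)) (sym (+-suc n d)) ⟩
  sRunWord (2 + (n + suc d)) ∎

length-middlePhrases : ∀ h t d → length (middlePhrases h t d) ≡ d
length-middlePhrases h t zero = refl
length-middlePhrases h t (suc d) = cong suc (length-middlePhrases h (suc t) d)

length-blockPhrases : ∀ n → length (blockPhrases n) ≡ suc (suc n)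
length-blockPhrases n = cong suc (trans (length-++ (middlePhrases (suc (suc n)) 1 n))
                                        (trans (cong (_+ 1) (length-middlePhrases _ 1 n)) (+-comm n 1)))

length-phrasesFrom : ∀ d n → 2 * length (phrasesFrom n d) ≡ d * (2 * n + d + 3)
length-phrasesFrom zero n = refl
length-phrasesFrom (suc d) n = begin
  2 * length (blockPhrases n ++ phrasesFrom (suc n) d)
    ≡⟨ cong (2 *_) (length-++ (blockPhrases n)) ⟩
  2 * (length (blockPhrases n) + length (phrasesFrom (suc n) d))
    ≡⟨ *-distribˡ-+ 2 (length (blockPhrases n)) _ ⟩
  2 * length (blockPhrases n) + 2 * length (phrasesFrom (suc n) d)
    ≡⟨ cong₂ (λ u v → 2 * u + v) (length-blockPhrases n) (length-phrasesFrom d (suc n)) ⟩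
  2 * (suc (suc n)) + d * (2 * suc n + d + 3)
    ≡⟨ arith d n ⟩
  suc d * (2 * n + suc d + 3) ∎
  where
  arith : ∀ d n → 2 * (suc (suc n)) + d * (2 * suc n + d + 3) ≡ suc d * (2 * n + suc d + 3)
  arith = solve-∀

initialPhrases : List Word
initialPhrases = (b ∷ []) ∷ (a ∷ []) ∷ (b ∷ a ∷ []) ∷ (a ∷ b ∷ a ∷ []) ∷ (b ∷ a ∷ a ∷ b ∷ a ∷ []) ∷ []

initial-LZ : ∀ rest → EmptyOrA (concat rest) → LZFrom (sRunWord 2) rest → LZFrom [] (initialPhrases ++ rest)
initial-LZ rest rest-a lz =
  step (inj₁ (b , refl , λ ()))
  (step (inj₁ (a , refl , λ { (here ()) ; (there ()) }))
  (step (maximal-before-a _ (b ∷ a ∷ []) _ (λ ()) ([] , [] , refl) (inj₂ (_ , refl)) baa⋢ba)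
  (step (maximal-phrase _ (a ∷ b ∷ a ∷ []) _ (λ ()) (b ∷ [] , [] , refl) (inj₂ (b , _ , refl , abab⋢baba)))
  (step (maximal-before-a _ (b ∷ a ∷ a ∷ b ∷ a ∷ []) (concat rest) (λ ()) (b ∷ a ∷ [] , [] , refl) rest-a baabaa⋢babaaba)
  lz))))
  where
  baa⋢ba : ¬ Substring (b ∷ a ∷ a ∷ []) (b ∷ a ∷ [])
  baa⋢ba occ with Substring⇒length≤ occ
  ... | s≤s (s≤s ())
  abab⋢baba : ¬ Substring (a ∷ b ∷ a ∷ b ∷ []) (b ∷ a ∷ b ∷ a ∷ [])
  abab⋢baba occ with Substring-equal-length occ refl
  ... | ()
  -- In run terms: 0,2 followed by a run ≥ 2 does not occur in 0,1,2 ; 1.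
  baabaa⋢babaaba : ¬ Substring (b ∷ a ∷ a ∷ b ∷ a ∷ a ∷ []) (b ∷ a ∷ b ∷ a ∷ a ∷ b ∷ a ∷ [])
  baabaa⋢babaaba occ with Substring⇒RunEmbedding 0 (2 ∷ []) 2 (0 ∷ 1 ∷ 2 ∷ []) 1 occ
  ... | [] , _ , _ , () , _
  ... | _ ∷ [] , _ , [] , refl , _ , s≤s ()
  ... | _ ∷ [] , _ , _ ∷ _ , () , _
  ... | _ ∷ _ ∷ [] , _ , _ , () , _
  ... | _ ∷ _ ∷ _ ∷ [] , _ , _ , () , _
  ... | _ ∷ _ ∷ _ ∷ _ ∷ _ , _ , _ , () , _

lzPhrases : ℕ → List Word
lzPhrases d = initialPhrases ++ phrasesFrom 0 d

lzPhrases-LZ : ∀ d → IsLZFactorization (sWord (2 + d)) (lzPhrases d)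
lzPhrases-LZ d =
  trans (sym (concat-++ initialPhrases (phrasesFrom 0 d))) (trans (concat-phrasesFrom d 0) (sym (sWord≡sRunWord (2 + d)))) ,
  initial-LZ (phrasesFrom 0 d) (phrasesFrom-EmptyOrA d 0) (phrasesFrom-LZ d 0)

length-lzPhrases : ∀ d → 2 * length (lzPhrases d) + (2 + d) ≡ (2 + d) * (2 + d) + 8
length-lzPhrases d = begin
  2 * length (initialPhrases ++ phrasesFrom 0 d) + (2 + d)
    ≡⟨ cong (λ z → 2 * z + (2 + d)) (length-++ initialPhrases {phrasesFrom 0 d}) ⟩
  2 * (5 + length (phrasesFrom 0 d)) + (2 + d)
    ≡⟨ cong (_+ (2 + d)) (*-distribˡ-+ 2 5 _) ⟩
  10 + 2 * length (phrasesFrom 0 d) + (2 + d)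
    ≡⟨ cong (λ z → 10 + z + (2 + d)) (length-phrasesFrom d 0) ⟩
  10 + d * (2 * 0 + d + 3) + (2 + d)
    ≡⟨ arith d ⟩
  (2 + d) * (2 + d) + 8 ∎
  where
  arith : ∀ d → 10 + d * (2 * 0 + d + 3) + (2 + d) ≡ (2 + d) * (2 + d) + 8
  arith = solve-∀

infix 4 _⊑_

data _⊑_ : Word → Word → Set where
  []⊑  : ∀ {v} → [] ⊑ v
  a⊑b  : ∀ {u v} → a ∷ u ⊑ b ∷ v
  ∷⊑∷  : ∀ {c u v} → u ⊑ v → c ∷ u ⊑ c ∷ v

⊑-refl : ∀ u → u ⊑ u
⊑-refl [] = []⊑
⊑-refl (c ∷ u) = ∷⊑∷ (⊑-refl u)

⊑-trans : ∀ {u v w} → u ⊑ v → v ⊑ w → u ⊑ w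
⊑-trans []⊑ _ = []⊑
⊑-trans a⊑b (∷⊑∷ _) = a⊑b
⊑-trans (∷⊑∷ _) a⊑b = a⊑b
⊑-trans (∷⊑∷ p) (∷⊑∷ q) = ∷⊑∷ (⊑-trans p q)

⊑-antisym : ∀ {u v} → u ⊑ v → v ⊑ u → u ≡ v
⊑-antisym []⊑ []⊑ = refl
⊑-antisym (∷⊑∷ p) (∷⊑∷ q) = cong (_ ∷_) (⊑-antisym p q)

⊑-++ʳ : ∀ {u v} w → u ⊑ v → u ⊑ v ++ w
⊑-++ʳ w []⊑ = []⊑
⊑-++ʳ w a⊑b = a⊑b
⊑-++ʳ w (∷⊑∷ p) = ∷⊑∷ (⊑-++ʳ w p)

⪯⇒⊑ : ∀ {u v} → u ⪯ v → u ⊑ v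
⪯⇒⊑ (inj₁ (w , refl)) = prefix _
  where
  prefix : ∀ u → u ⊑ u ++ w
  prefix [] = []⊑
  prefix (c ∷ u) = ∷⊑∷ (prefix u)
⪯⇒⊑ (inj₂ (x , c , d , w₁ , w₂ , c≺d , refl , refl)) = mismatch x c≺d
  where
  mismatch : ∀ x {c d w₁ w₂} → c ≺ₗ d → x ++ c ∷ w₁ ⊑ x ++ d ∷ w₂
  mismatch [] a≺b = a⊑b
  mismatch (e ∷ x) p = ∷⊑∷ (mismatch x p)

≺⇒⊑ : ∀ {u v} → u ≺ v → u ⊑ v
≺⇒⊑ (u⪯v , _) = ⪯⇒⊑ u⪯v

≺-∷⁺ : ∀ c {u v} → u ≺ v → (c ∷ u) ≺ (c ∷ v)
≺-∷⁺ c (inj₁ (w , e) , u≢v) = inj₁ (w , cong (c ∷_) e) , λ e′ → u≢v (∷-injectiveʳ e′)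
≺-∷⁺ c (inj₂ (x , c₁ , d , w₁ , w₂ , p , e₁ , e₂) , u≢v) =
  inj₂ (c ∷ x , c₁ , d , w₁ , w₂ , p , cong (c ∷_) e₁ , cong (c ∷_) e₂) , λ e′ → u≢v (∷-injectiveʳ e′)

≺-++⁺ˡ : ∀ x {u v} → u ≺ v → (x ++ u) ≺ (x ++ v)
≺-++⁺ˡ [] p = p
≺-++⁺ˡ (c ∷ x) p = ≺-∷⁺ c (≺-++⁺ˡ x p)

proper-prefix-≺ : ∀ u w → w ≢ [] → u ≺ (u ++ w)
proper-prefix-≺ u w w≢[] = inj₁ (w , refl) , λ e → w≢[] (sym (++-cancelˡ u [] w (trans (++-identityʳ u) e)))

longer-aRun-≺ : ∀ m n w y → m < n → (aRun n ++ w) ≺ (aRun m ++ b ∷ y)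
longer-aRun-≺ zero (suc n) w y _ = inj₂ ([] , a , b , aRun n ++ w , y , a≺b , refl , refl) , λ ()
longer-aRun-≺ (suc m) (suc n) w y (s≤s m<n) = ≺-∷⁺ a (longer-aRun-≺ m n w y m<n)

split-aRun-b : ∀ n v x y → x ++ y ≡ aRun n ++ b ∷ v →
  (Σ ℕ λ m → y ≡ aRun m ++ b ∷ v × m + length x ≡ n) ⊎ (∃ λ x′ → x′ ++ y ≡ v)
split-aRun-b zero v [] y e = inj₁ (0 , e , refl)
split-aRun-b zero v (c ∷ x) y e with ∷-injective e
... | refl , e′ = inj₂ (x , e′)
split-aRun-b (suc n) v [] y e = inj₁ (suc n , e , +-identityʳ (suc n))
split-aRun-b (suc n) v (c ∷ x) y e with ∷-injective e
... | refl , e′ with split-aRun-b n v x y e′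
... | inj₁ (m , ey , el) = inj₁ (m , ey , trans (+-suc m (length x)) (cong suc el))
... | inj₂ r = inj₂ r

SuffixesStartBelow : ℕ → Word → Set
SuffixesStartBelow n v = ∀ x y → x ++ y ≡ v → y ≢ [] → Σ ℕ λ m → Σ Word λ y′ → m < n × y ≡ aRun m ++ b ∷ y′

SuffixesStartBelow-[] : ∀ n → SuffixesStartBelow n []
SuffixesStartBelow-[] n x y e y≢[] = ⊥-elim (y≢[] (++-conicalʳ x y e))

SuffixesStartBelow-∷ : ∀ n m v → m < n → SuffixesStartBelow n v → SuffixesStartBelow n (aRun m ++ b ∷ v)
SuffixesStartBelow-∷ n m v m<n below x y e y≢[] with split-aRun-b m v x y e
... | inj₁ (m′ , ey , el) = m′ , v , ≤-<-trans (subst (m′ ≤_) el (m≤m+n m′ (length x))) m<n , ey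
... | inj₂ (x′ , e′) = below x′ y e′ y≢[]

aRun-b-Lyndon : ∀ n v → 1 ≤ n → SuffixesStartBelow n v → IsLyndon (aRun n ++ b ∷ v)
aRun-b-Lyndon n v 1≤n below = aRun-b-nonempty n v , smaller
  where
  smaller : ∀ x y → x ++ y ≡ aRun n ++ b ∷ v → x ≢ [] → y ≢ [] → (aRun n ++ b ∷ v) ≺ y
  smaller x y e x≢[] y≢[] with split-aRun-b n v x y e
  smaller [] y e x≢[] y≢[] | inj₁ _ = ⊥-elim (x≢[] refl)
  smaller (c ∷ x) y e x≢[] y≢[] | inj₁ (m , refl , el) =
    longer-aRun-≺ m n (b ∷ v) v (subst (m <_) el (subst (_≤ m + suc (length x)) (+-comm m 1) (+-monoʳ-≤ m (s≤s z≤n))))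
  ... | inj₂ (x′ , e′) with below x′ y e′ y≢[]
  ...   | m , y′ , m<n , refl = longer-aRun-≺ m n (b ∷ v) y′ m<n

letter-Lyndon : ∀ c → IsLyndon (c ∷ [])
letter-Lyndon c = (λ ()) , smaller
  where
  smaller : ∀ x y → x ++ y ≡ c ∷ [] → x ≢ [] → y ≢ [] → (c ∷ []) ≺ y
  smaller [] y e x≢[] _ = ⊥-elim (x≢[] refl)
  smaller (d ∷ x) y e _ y≢[] = ⊥-elim (y≢[] (++-conicalʳ x y (∷-injectiveʳ e)))

aib-Lyndon : ∀ i → 1 ≤ i → IsLyndon (bRuns (i ∷ []))
aib-Lyndon i 1≤i = aRun-b-Lyndon i [] 1≤i (SuffixesStartBelow-[] i)

aibajb-Lyndon : ∀ i j → j < i → IsLyndon (bRuns (i ∷ j ∷ []))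
aibajb-Lyndon i j j<i = aRun-b-Lyndon i (aRun j ++ b ∷ []) (≤-trans (s≤s z≤n) j<i)
  (SuffixesStartBelow-∷ i j [] j<i (SuffixesStartBelow-[] i))

-- The Lyndon factorization of s_k

pairFactors : ℕ → ℕ → List Word
pairFactors i t = map (λ j → bRuns (i ∷ j ∷ [])) (map suc (upTo t))

blockFactors : ℕ → List Word
blockFactors zero = bRuns (0 ∷ []) ∷ []
blockFactors (suc n) = pairFactors (suc n) n ++ bRuns (suc n ∷ []) ∷ []

factorsUpTo : ℕ → List Word
factorsUpTo zero = blockFactors zero
factorsUpTo (suc k) = factorsUpTo k ++ blockFactors (suc k)

lyndonFactors : ℕ → List Word
lyndonFactors k = factorsUpTo k ++ aRun 1 ∷ []

pairFactors-suc : ∀ i t → pairFactors i (suc t) ≡ pairFactors i t ++ bRuns (i ∷ suc t ∷ []) ∷ []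
pairFactors-suc i t = trans (cong (map (λ j → bRuns (i ∷ j ∷ []))) (map-suc-upTo-suc t))
                            (map-++ (λ j → bRuns (i ∷ j ∷ [])) (map suc (upTo t)) (suc t ∷ []))

concat-blockFactors : ∀ i → concat (blockFactors i) ≡ bRuns (blockRuns i)
concat-blockFactors zero = refl
concat-blockFactors (suc n) = begin
  concat (pairFactors (suc n) n ++ bRuns (suc n ∷ []) ∷ [])
    ≡⟨ sym (concat-++ (pairFactors (suc n) n) _) ⟩
  concat (pairFactors (suc n) n) ++ bRuns (suc n ∷ []) ++ []
    ≡⟨ cong₂ _++_ (pairs (map suc (upTo n))) (++-identityʳ _) ⟩
  bRuns (pairRuns (suc n) n) ++ bRuns (suc n ∷ [])
    ≡⟨ sym (bRuns-++ (pairRuns (suc n) n) _) ⟩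
  bRuns (blockRuns (suc n)) ∎
  where
  pairs : ∀ js → concat (map (λ j → bRuns (suc n ∷ j ∷ [])) js) ≡ bRuns (concat (map (λ j → suc n ∷ j ∷ []) js))
  pairs [] = refl
  pairs (j ∷ js) = trans (cong (bRuns (suc n ∷ j ∷ []) ++_) (pairs js))
                         (sym (bRuns-++ (suc n ∷ j ∷ []) (concat (map (λ j → suc n ∷ j ∷ []) js))))

concat-factorsUpTo : ∀ k → concat (factorsUpTo k) ≡ bRuns (sRuns k)
concat-factorsUpTo zero = refl
concat-factorsUpTo (suc k) = begin
  concat (factorsUpTo k ++ blockFactors (suc k))
    ≡⟨ sym (concat-++ (factorsUpTo k) _) ⟩
  concat (factorsUpTo k) ++ concat (blockFactors (suc k))
    ≡⟨ cong₂ _++_ (concat-factorsUpTo k) (concat-blockFactors (suc k)) ⟩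
  bRuns (sRuns k) ++ bRuns (blockRuns (suc k))
    ≡⟨ sym (bRuns-++ (sRuns k) _) ⟩
  bRuns (sRuns k ++ blockRuns (suc k))
    ≡⟨ cong bRuns (sym (sRuns-suc k)) ⟩
  bRuns (sRuns (suc k)) ∎

concat-lyndonFactors : ∀ k → concat (lyndonFactors k) ≡ sWord k
concat-lyndonFactors k =
  trans (sym (concat-++ (factorsUpTo k) _)) (trans (cong (_++ aRun 1 ++ []) (concat-factorsUpTo k)) (sym (sWord≡sRunWord k)))

lyndonFactors-Lyndon : ∀ k → All IsLyndon (lyndonFactors k)
lyndonFactors-Lyndon k = ++⁺ (upTo-Lyndon k) (letter-Lyndon a ∷ [])
  where
  pairs-Lyndon : ∀ i t → t < i → All IsLyndon (pairFactors i t)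
  pairs-Lyndon i zero _ = []
  pairs-Lyndon i (suc t) 1+t<i = subst (All IsLyndon) (sym (pairFactors-suc i t))
    (++⁺ (pairs-Lyndon i t (≤-trans (n≤1+n _) 1+t<i)) (aibajb-Lyndon i (suc t) 1+t<i ∷ []))
  block-Lyndon : ∀ i → All IsLyndon (blockFactors i)
  block-Lyndon zero = letter-Lyndon b ∷ []
  block-Lyndon (suc n) = ++⁺ (pairs-Lyndon (suc n) n ≤-refl) (aib-Lyndon (suc n) (s≤s z≤n) ∷ [])
  upTo-Lyndon : ∀ k → All IsLyndon (factorsUpTo k)
  upTo-Lyndon zero = block-Lyndon zero
  upTo-Lyndon (suc k) = ++⁺ (upTo-Lyndon k) (block-Lyndon (suc k))

length-lyndonFactors : ∀ k → 2 * length (lyndonFactors k) ≡ k * k + k + 4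
length-lyndonFactors k = begin
  2 * length (factorsUpTo k ++ aRun 1 ∷ []) ≡⟨ cong (2 *_) (length-++ (factorsUpTo k)) ⟩
  2 * (length (factorsUpTo k) + 1)          ≡⟨ *-distribˡ-+ 2 (length (factorsUpTo k)) 1 ⟩
  2 * length (factorsUpTo k) + 2            ≡⟨ cong (_+ 2) (upTo-length k) ⟩
  k * k + k + 2 + 2                         ≡⟨ +-assoc (k * k + k) 2 2 ⟩
  k * k + k + 4 ∎
  where
  pairs-length : ∀ i t → length (pairFactors i t) ≡ t
  pairs-length i t = trans (length-map _ (map suc (upTo t))) (trans (length-map suc (upTo t)) (length-upTo t))
  arith : ∀ k → k * k + k + 2 + 2 * (k + 1) ≡ suc k * suc k + suc k + 2
  arith = solve-∀
  upTo-length : ∀ k → 2 * length (factorsUpTo k) ≡ k * k + k + 2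
  upTo-length zero = refl
  upTo-length (suc k) = begin
    2 * length (factorsUpTo k ++ blockFactors (suc k))   ≡⟨ cong (2 *_) (length-++ (factorsUpTo k)) ⟩
    2 * (length (factorsUpTo k) + length (blockFactors (suc k)))
      ≡⟨ cong (λ z → 2 * (length (factorsUpTo k) + z)) (trans (length-++ (pairFactors (suc k) k)) (cong (_+ 1) (pairs-length (suc k) k))) ⟩
    2 * (length (factorsUpTo k) + (k + 1))               ≡⟨ *-distribˡ-+ 2 (length (factorsUpTo k)) _ ⟩
    2 * length (factorsUpTo k) + 2 * (k + 1)             ≡⟨ cong (_+ 2 * (k + 1)) (upTo-length k) ⟩
    k * k + k + 2 + 2 * (k + 1)                          ≡⟨ arith k ⟩
    suc k * suc k + suc k + 2 ∎

_≻_ : Word → Word → Set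
u ≻ v = v ≺ u

aib≺aibajb : ∀ i j → bRuns (i ∷ []) ≺ bRuns (i ∷ j ∷ [])
aib≺aibajb i j = subst (bRuns (i ∷ []) ≺_) (++-assoc (aRun i) (b ∷ []) (aRun j ++ b ∷ []))
  (proper-prefix-≺ (aRun i ++ b ∷ []) (aRun j ++ b ∷ []) (aRun-b-nonempty j []))

aibaj+1b≺aibajb : ∀ i j → bRuns (i ∷ suc j ∷ []) ≺ bRuns (i ∷ j ∷ [])
aibaj+1b≺aibajb i j = subst₂ _≺_ (++-assoc (aRun i) (b ∷ []) _) (++-assoc (aRun i) (b ∷ []) _)
  (≺-++⁺ˡ (aRun i ++ b ∷ []) (longer-aRun-≺ j (suc j) (b ∷ []) [] ≤-refl))

below-aib : ∀ k w → (aRun (suc k) ++ w) ≺ bRuns (k ∷ [])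
below-aib k w = longer-aRun-≺ k (suc k) w [] ≤-refl

decreasing-through-pairs : ∀ k → Chain _≻_ (factorsUpTo k) (bRuns (k ∷ [])) → ∀ t → t ≤ k →
  Σ Word λ l → Chain _≻_ (factorsUpTo k ++ pairFactors (suc k) t) l × l ≻ bRuns (suc k ∷ []) × l ≻ bRuns (suc k ∷ suc t ∷ [])
decreasing-through-pairs k chain zero _ = bRuns (k ∷ []) ,
  Chain-resp (sym (++-identityʳ _)) chain ,
  below-aib k (b ∷ []) , below-aib k (b ∷ aRun 1 ++ b ∷ [])
decreasing-through-pairs k chain (suc t) 1+t≤k with decreasing-through-pairs k chain t (≤-trans (n≤1+n t) 1+t≤k)
... | l , chain′ , _ , l≻next = bRuns (suc k ∷ suc t ∷ []) ,
  Chain-resp (trans (++-assoc (factorsUpTo k) _ _) (cong (factorsUpTo k ++_) (sym (pairFactors-suc (suc k) t))))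
    (Chain-∷ʳ chain′ l≻next) ,
  aib≺aibajb (suc k) (suc t) , aibaj+1b≺aibajb (suc k) (suc t)

factorsUpTo-decreasing : ∀ k → Chain _≻_ (factorsUpTo k) (bRuns (k ∷ []))
factorsUpTo-decreasing zero = end _
factorsUpTo-decreasing (suc k) with decreasing-through-pairs k (factorsUpTo-decreasing k) k ≤-refl
... | l , chain , l≻aib , _ = Chain-resp (++-assoc (factorsUpTo k) _ _) (Chain-∷ʳ chain l≻aib)

lyndonFactors-decreasing : ∀ k → Linked _≻_ (lyndonFactors (suc k))
lyndonFactors-decreasing k = Chain⇒Linked (Chain-∷ʳ (factorsUpTo-decreasing (suc k))
  (proper-prefix-≺ (a ∷ []) (aRun k ++ b ∷ []) (aRun-b-nonempty k [])))

-- Uniqueness of Lyndon factorizations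

NonIncreasing : List Word → Set
NonIncreasing = Linked (λ u v → v ⊑ u)

split-++ : ∀ (x v l r : Word) → x ++ v ≡ l ++ r →
  (∃ λ x′ → x ≡ l ++ x′ × x′ ++ v ≡ r) ⊎ (∃ λ y → y ≢ [] × x ++ y ≡ l × v ≡ y ++ r)
split-++ [] v [] r e = inj₁ ([] , refl , e)
split-++ [] v (c ∷ l) r e = inj₂ (c ∷ l , (λ ()) , refl , e)
split-++ (c ∷ x) v [] r e = inj₁ (c ∷ x , refl , e)
split-++ (c ∷ x) v (d ∷ l) r e with ∷-injective e
... | refl , e′ with split-++ x v l r e′
... | inj₁ (x′ , e₁ , e₂) = inj₁ (x′ , cong (c ∷_) e₁ , e₂)
... | inj₂ (y , y≢[] , e₁ , e₂) = inj₂ (y , y≢[] , cong (c ∷_) e₁ , e₂)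

-- A nonempty suffix starts inside some factor l, and that suffix of l is ⊒ l ⊒ m.
suffix-of-concat-⊒ : ∀ m L → All IsLyndon L → All (m ⊑_) L → ∀ x v → x ++ v ≡ concat L → v ≢ [] → m ⊑ v
suffix-of-concat-⊒ m [] _ _ x v e v≢[] = ⊥-elim (v≢[] (++-conicalʳ x v e))
suffix-of-concat-⊒ m (l ∷ L) (lyn ∷ lyns) (m⊑l ∷ m⊑L) x v e v≢[] with split-++ x v l (concat L) e
... | inj₁ (x′ , _ , e′) = suffix-of-concat-⊒ m L lyns m⊑L x′ v e′ v≢[]
... | inj₂ (y , y≢[] , e₁ , refl) = ⊑-++ʳ (concat L) (⊑-trans m⊑l (l⊑y x e₁))
  where
  l⊑y : ∀ x → x ++ y ≡ l → l ⊑ y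
  l⊑y [] refl = ⊑-refl y
  l⊑y (c ∷ x) e₁ = ≺⇒⊑ (proj₂ lyn (c ∷ x) y e₁ (λ ()) y≢[])

last-⊑-all : ∀ L m → NonIncreasing (L ++ m ∷ []) → All (m ⊑_) (L ++ m ∷ [])
last-⊑-all L m noninc = ++⁺ (before L (Linked⇒AllPairs (λ p q → ⊑-trans q p) noninc)) (⊑-refl m ∷ [])
  where
  before : ∀ L → AllPairs (λ u v → v ⊑ u) (L ++ m ∷ []) → All (m ⊑_) L
  before [] _ = []
  before (x ∷ L) (px ∷ ps) with ++⁻ʳ L px
  ... | r ∷ [] = r ∷ before L ps

Linked-++⁻ˡ : ∀ {R : Word → Word → Set} xs ys → Linked R (xs ++ ys) → Linked R xs
Linked-++⁻ˡ [] ys _ = []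
Linked-++⁻ˡ (x ∷ []) ys _ = [-]
Linked-++⁻ˡ (x ∷ y ∷ xs) ys (r ∷ p) = r ∷ Linked-++⁻ˡ (y ∷ xs) ys p

concat-∷ʳ : ∀ L (m : Word) → concat (L ++ m ∷ []) ≡ concat L ++ m
concat-∷ʳ L m = trans (sym (concat-++ L (m ∷ []))) (cong (concat L ++_) (++-identityʳ m))

-- Both last factors are the ⊑-least nonempty suffix of the word, so they agree; then recurse on
-- the remaining prefix (the natural number bounds the recursion depth).
Lyndon-factorization-unique′ : ∀ n L L′ → length L ≤ n → NonIncreasing L → All IsLyndon L →
  NonIncreasing L′ → All IsLyndon L′ → concat L ≡ concat L′ → L ≡ L′
Lyndon-factorization-unique′ n L L′ _ _ lyn _ lyn′ e with initLast L | initLast L′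
... | [] | [] = refl
... | [] | L₀′ ∷ʳ′ m′ = ⊥-elim (proj₁ (proj₂ (∷ʳ⁻ lyn′)) (++-conicalʳ (concat L₀′) m′ (sym (trans e (concat-∷ʳ L₀′ m′)))))
... | L₀ ∷ʳ′ m | [] = ⊥-elim (proj₁ (proj₂ (∷ʳ⁻ lyn)) (++-conicalʳ (concat L₀) m (trans (sym (concat-∷ʳ L₀ m)) e)))
Lyndon-factorization-unique′ zero _ _ |L|≤0 _ _ _ _ _ | L₀ ∷ʳ′ m | _ ∷ʳ′ _
  with subst (_≤ 0) (trans (length-++ L₀) (+-comm (length L₀) 1)) |L|≤0
... | ()
Lyndon-factorization-unique′ (suc n) _ _ |L|≤1+n noninc lyn noninc′ lyn′ e | L₀ ∷ʳ′ m | L₀′ ∷ʳ′ m′ =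
  cong₂ (λ u v → u ++ v ∷ [])
    (Lyndon-factorization-unique′ n L₀ L₀′ |L₀|≤n (Linked-++⁻ˡ L₀ (m ∷ []) noninc) (proj₁ (∷ʳ⁻ lyn))
      (Linked-++⁻ˡ L₀′ (m′ ∷ []) noninc′) (proj₁ (∷ʳ⁻ lyn′)) concat-L₀)
    m≡m′
  where
  E : concat L₀ ++ m ≡ concat L₀′ ++ m′
  E = trans (sym (concat-∷ʳ L₀ m)) (trans e (concat-∷ʳ L₀′ m′))
  m≡m′ : m ≡ m′
  m≡m′ = ⊑-antisym
    (suffix-of-concat-⊒ m (L₀ ++ m ∷ []) lyn (last-⊑-all L₀ m noninc) (concat L₀′) m′
      (trans (sym E) (sym (concat-∷ʳ L₀ m))) (proj₁ (proj₂ (∷ʳ⁻ lyn′))))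
    (suffix-of-concat-⊒ m′ (L₀′ ++ m′ ∷ []) lyn′ (last-⊑-all L₀′ m′ noninc′) (concat L₀) m
      (trans E (sym (concat-∷ʳ L₀′ m′))) (proj₁ (proj₂ (∷ʳ⁻ lyn))))
  concat-L₀ : concat L₀ ≡ concat L₀′
  concat-L₀ = ++-cancelʳ m (concat L₀) (concat L₀′) (trans E (cong (concat L₀′ ++_) (sym m≡m′)))
  |L₀|≤n : length L₀ ≤ n
  |L₀|≤n = ≤-pred (subst (_≤ suc n) (trans (length-++ L₀) (+-comm (length L₀) 1)) |L|≤1+n)

Lyndon-factorization-unique : ∀ L L′ → NonIncreasing L → All IsLyndon L →
  NonIncreasing L′ → All IsLyndon L′ → concat L ≡ concat L′ → L ≡ L′
Lyndon-factorization-unique L L′ = Lyndon-factorization-unique′ (length L) L L′ ≤-refl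

expand : List (Word × ℕ) → List Word
expand [] = []
expand ((f , e) ∷ fs) = replicate e f ++ expand fs

concat-expand : ∀ fs → concat (map pow fs) ≡ concat (expand fs)
concat-expand [] = refl
concat-expand ((f , e) ∷ fs) = trans (cong (concat (replicate e f) ++_) (concat-expand fs)) (concat-++ (replicate e f) (expand fs))

expand-Lyndon : ∀ fs → All GoodFactor fs → All IsLyndon (expand fs)
expand-Lyndon [] [] = []
expand-Lyndon ((f , e) ∷ fs) ((lyn , _) ∷ goods) = ++⁺ (replicate⁺ e lyn) (expand-Lyndon fs goods)

NonIncreasing-replicate : ∀ {f rest} e → NonIncreasing (f ∷ rest) → NonIncreasing (f ∷ replicate e f ++ rest)
NonIncreasing-replicate zero p = p
NonIncreasing-replicate {f} (suc e) p = ⊑-refl f ∷ NonIncreasing-replicate e p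

expand-NonIncreasing : ∀ fs → Linked Decr fs → All GoodFactor fs → NonIncreasing (expand fs)
expand-NonIncreasing [] _ _ = []
expand-NonIncreasing ((f , zero) ∷ fs) _ ((_ , ()) ∷ _)
expand-NonIncreasing ((f , suc e) ∷ []) _ _ = NonIncreasing-replicate e [-]
expand-NonIncreasing ((f , suc e) ∷ (g , zero) ∷ fs) _ (_ ∷ (_ , ()) ∷ _)
expand-NonIncreasing ((f , suc e) ∷ (g , suc e′) ∷ fs) (g≺f ∷ decr) (_ ∷ goods) =
  NonIncreasing-replicate e (≺⇒⊑ g≺f ∷ expand-NonIncreasing ((g , suc e′) ∷ fs) decr goods)

-- When no two adjacent words of the expansion are equal, every exponent is 1.
length-expand : ∀ fs → All GoodFactor fs → Linked _≢_ (expand fs) → length (expand fs) ≡ length fs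
length-expand [] _ _ = refl
length-expand ((f , zero) ∷ fs) ((_ , ()) ∷ _) _
length-expand ((f , suc zero) ∷ fs) (_ ∷ goods) distinct = cong suc (length-expand fs goods (Linked.tail distinct))
length-expand ((f , suc (suc e)) ∷ fs) _ (f≢f ∷ _) = ⊥-elim (f≢f refl)

≤-offset-elim : ∀ m (P : ℕ → Set) → (∀ d → P (m + d)) → ∀ k → m ≤ k → P k
≤-offset-elim m P f k m≤k with m≤n⇒∃[o]m+o≡n m≤k
... | d , refl = f d

exponentOne : List Word → List (Word × ℕ)
exponentOne = map (_, 1)

expand-exponentOne : ∀ L → expand (exponentOne L) ≡ L
expand-exponentOne [] = refl
expand-exponentOne (w ∷ L) = cong (w ∷_) (expand-exponentOne L)

lyndonFactors-factorization : ∀ k → IsLyndonFactorization (sWord (suc k)) (exponentOne (lyndonFactors (suc k)))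
lyndonFactors-factorization k =
  trans (concat-expand (exponentOne L)) (trans (cong concat (expand-exponentOne L)) (concat-lyndonFactors (suc k))) ,
  All-map⁺ (All.map (_, ≤-refl) (lyndonFactors-Lyndon (suc k))) ,
  Linked-map⁺ (lyndonFactors-decreasing k)
  where
  L : List Word
  L = lyndonFactors (suc k)

lyndon-size : ∀ k fs → IsLyndonFactorization (sWord (suc k)) fs → length fs ≡ length (lyndonFactors (suc k))
lyndon-size k fs (concat≡ , goods , decr) = trans (sym (length-expand fs goods distinct)) (cong length expand≡)
  where
  decreasing : Linked _≻_ (lyndonFactors (suc k))
  decreasing = lyndonFactors-decreasing k
  expand≡ : expand fs ≡ lyndonFactors (suc k)
  expand≡ = Lyndon-factorization-unique (expand fs) (lyndonFactors (suc k))
    (expand-NonIncreasing fs decr goods) (expand-Lyndon fs goods)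
    (Linked.map ≺⇒⊑ decreasing) (lyndonFactors-Lyndon (suc k))
    (trans (sym (concat-expand fs)) (trans concat≡ (sym (concat-lyndonFactors (suc k)))))
  distinct : Linked _≢_ (expand fs)
  distinct = subst (Linked _≢_) (sym expand≡) (Linked.map (λ (_ , v≢u) u≡v → v≢u (sym u≡v)) decreasing)

lz-size : ∀ d ps → IsLZFactorization (sWord (2 + d)) ps → length ps ≡ length (lzPhrases d)
lz-size d ps (concat≡ , lz) = LZFrom-length-unique lz (proj₂ (lzPhrases-LZ d)) (trans concat≡ (sym (proj₁ (lzPhrases-LZ d))))

size-difference : ∀ d m z → 2 * m ≡ (2 + d) * (2 + d) + (2 + d) + 4 → 2 * z + (2 + d) ≡ (2 + d) * (2 + d) + 8 → m ≡ z + d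
size-difference d m z 2m≡ 2z≡ = *-cancelˡ-≡ m (z + d) 2 (+-cancelʳ-≡ (2 + d) _ _ (begin
  2 * m + (2 + d)                           ≡⟨ cong (_+ (2 + d)) 2m≡ ⟩
  (2 + d) * (2 + d) + (2 + d) + 4 + (2 + d) ≡⟨ arith₁ d ⟩
  (2 + d) * (2 + d) + 8 + 2 * d             ≡⟨ cong (_+ 2 * d) (sym 2z≡) ⟩
  2 * z + (2 + d) + 2 * d                   ≡⟨ arith₂ z d ⟩
  2 * (z + d) + (2 + d) ∎))
  where
  arith₁ : ∀ d → (2 + d) * (2 + d) + (2 + d) + 4 + (2 + d) ≡ (2 + d) * (2 + d) + 8 + 2 * d
  arith₁ = solve-∀
  arith₂ : ∀ z d → 2 * z + (2 + d) + 2 * d ≡ 2 * (z + d) + (2 + d)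
  arith₂ = solve-∀

-- Fails for d ≤ 2, whence d = 3 + n.
square-comparable : ∀ n z → let d = 3 + n in 2 * z + (2 + d) ≡ (2 + d) * (2 + d) + 8 → z ≤ 2 * (d * d) × d * d ≤ 2 * z
square-comparable n z 2z≡ =
  *-cancelˡ-≤ 2 (+-cancelʳ-≤ (5 + n) _ _ (subst₂ _≤_ (sym 2z≡) (sym (arith₁ n)) (m≤m+n _ _))) ,
  subst ((3 + n) * (3 + n) ≤_) (+-cancelʳ-≡ (5 + n) _ _ (trans (arith₂ n) (sym 2z≡))) (m≤m+n _ _)
  where
  arith₁ : ∀ n → 2 * (2 * ((3 + n) * (3 + n))) + (5 + n) ≡ (5 + n) * (5 + n) + 8 + (3 * n * n + 15 * n + 8)
  arith₁ = solve-∀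
  arith₂ : ∀ n → (3 + n) * (3 + n) + (3 * n + 19) + (5 + n) ≡ (5 + n) * (5 + n) + 8
  arith₂ = solve-∀

lyndon-count : ∀ k fs → IsLyndonFactorization (sWord (suc k)) fs → 2 * length fs ≡ suc k * suc k + suc k + 4
lyndon-count k fs fact = trans (cong (2 *_) (lyndon-size k fs fact)) (length-lyndonFactors (suc k))

lz-count : ∀ d ps → IsLZFactorization (sWord (2 + d)) ps → 2 * length ps + (2 + d) ≡ (2 + d) * (2 + d) + 8
lz-count d ps fact = trans (cong (λ z → 2 * z + (2 + d)) (lz-size d ps fact)) (length-lzPhrases d)

gap-square-comparable : ∀ n fs ps → let k = 5 + n in
  IsLyndonFactorization (sWord k) fs → IsLZFactorization (sWord k) ps →
  length ps ≤ 2 * ((length fs ∸ length ps) * (length fs ∸ length ps))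
  × (length fs ∸ length ps) * (length fs ∸ length ps) ≤ 2 * length ps
gap-square-comparable n fs ps lyn lz =
  subst (λ g → length ps ≤ 2 * (g * g) × g * g ≤ 2 * length ps) (sym gap) (square-comparable n (length ps) 2z≡)
  where
  2z≡ : 2 * length ps + (5 + n) ≡ (5 + n) * (5 + n) + 8
  2z≡ = lz-count (3 + n) ps lz
  gap : length fs ∸ length ps ≡ 3 + n
  gap = trans (cong (_∸ length ps) (size-difference (3 + n) (length fs) (length ps) (lyndon-count (4 + n) fs lyn) 2z≡))
              (m+n∸m≡n (length ps) (3 + n))

theorem2 : ((k : ℕ) → 2 ≤ k →
               (Σ (List (Word × ℕ)) λ fs → IsLyndonFactorization (sWord k) fs
                  × 2 * length fs ≡ k * k + k + 4)
             × (∀ fs → IsLyndonFactorization (sWord k) fs → 2 * length fs ≡ k * k + k + 4)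
             × (Σ (List Word) λ ps → IsLZFactorization (sWord k) ps
                  × 2 * length ps + k ≡ k * k + 8)
             × (∀ ps → IsLZFactorization (sWord k) ps → 2 * length ps + k ≡ k * k + 8))
           × (Σ ℕ λ p → Σ ℕ λ q → Σ ℕ λ K → (k : ℕ) → K ≤ k →
               ∀ fs ps → IsLyndonFactorization (sWord k) fs → IsLZFactorization (sWord k) ps →
               length ps ≤ p * ((length fs ∸ length ps) * (length fs ∸ length ps))
               × (length fs ∸ length ps) * (length fs ∸ length ps) ≤ q * length ps)
theorem2 =
  ≤-offset-elim 2 _ (λ d →
    (_ , lyndonFactors-factorization (suc d) , lyndon-count (suc d) _ (lyndonFactors-factorization (suc d))) ,
    lyndon-count (suc d) ,
    (lzPhrases d , lzPhrases-LZ d , lz-count d _ (lzPhrases-LZ d)) ,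
    lz-count d) ,
  2 , 2 , 5 , ≤-offset-elim 5 _ gap-square-comparable
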